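{- For $n\ge1$ and $1\le k\le n$, $$s_{q,t}[n,k]=s_{q,t}[n-1,k-1]-[n-1]_{q,t}\,s_{q,t}[n-1,k]$$ and $$S_{q,t}[n,k]=S_{q,t}[n-1,k-1]+[k]_{q,t}\,S_{q,t}[n-1,k],$$ with $s_{q,t}[n,0]=S_{q,t}[n,0]=\delta_{n,0}$ and $s_{q,t}[n,k]=S_{q,t}[n,k]=0$ for $k>n$.
   Context: $q,t$ are indeterminates. $[0]_{q,t}=0$; for even $k\ge2$, $[k]_{q,t}=(1+q^2+\dots+q^{k-2})\,t$; for odd $k\ge1$, $[k]_{q,t}=q^{k-1}+(1+q^2+\dots+q^{k-3})\,t$. RG-words: $\mathcal R(n,k)$ is the set of words $w=w_1\cdots w_n$ of positive integers with $w_1=1$, $w_i\le\max(w_1,\dots,w_{i-1})+1$, $\max_iw_i=k$; $\mathcal A(n,k)$ is the subset in which each even letter occurs exactly once. With $m_i=\max(w_1,\dots,w_i)$, $A(w)=\sum_{i\ge2}A_i(w)$ where $A_i(w)=w_i-1$ if $m_{i-1}\ge w_i$ and $0$ otherwise, and $B(w)=\#\{i\ge2:m_{i-1}>w_i\}$. For $n\ge1$, $1\le k\le n$: $S_{q,t}[n,k]=\sum_{w\in\mathcal A(n,k)}q^{A(w)}t^{B(w)}$. Rooks: the staircase board of length $n$ has squares $(i,j)$, $i,j\ge1$, $i+j\le n$ (row $i$ from top, column $j$ from left); $(i,j)$ has $n-i-j$ squares below it and is shaded if $n-i-j$ is even. $\mathcal{AR}(n,r)$ is the set of placements of $r$ rooks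 on shaded squares, no two in the same column; $\mathrm{below}(T)$ is the total number of squares below rooks, $\mathrm{nrow}(T)$ the number of rooks not in row $1$. For $n\ge1$, $0\le k\le n$: $s_{q,t}[n,k]=(-1)^{n-k}\sum_{T\in\mathcal{AR}(n,n-k)}q^{\mathrm{below}(T)}t^{\mathrm{nrow}(T)}$; $s_{q,t}[0,0]=S_{q,t}[0,0]=1$. -}

module Defs where

open import Data.Bool using (Bool; true; false; if_then_else_; _∧_; _∨_; not)
open import Data.Nat using (ℕ; zero; suc; _+_; _∸_; _⊔_; _≡ᵇ_; _≤ᵇ_; _<ᵇ_; ⌊_/2⌋)
  renaming (_*_ to _*ℕ_)
open import Data.Integer using (ℤ; +_; -_; 0ℤ; 1ℤ; -1ℤ) renaming (_+_ to _+ℤ_; _*_ to _*ℤ_)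
open import Data.List using (List; []; _∷_; _++_; map; concatMap; filterᵇ; upTo; length; foldr)
open import Data.Product using (_×_; _,_)
open import Relation.Binary.PropositionalEquality using (_≡_)

-- Polynomials in ℤ[q,t] as formal sums of monomials c·q^a·t^b,
-- compared by their coefficients.

Poly : Set
Poly = List (ℤ × ℕ × ℕ)

coeff : Poly → ℕ → ℕ → ℤ
coeff [] a b = 0ℤ
coeff ((c , i , j) ∷ p) a b = (if (a ≡ᵇ i) ∧ (b ≡ᵇ j) then c else 0ℤ) +ℤ coeff p a b

infix 4 _≈P_
_≈P_ : Poly → Poly → Set
p ≈P r = ∀ a b → coeff p a b ≡ coeff r a b

0P 1P : Poly
0P = []
1P = (1ℤ , 0 , 0) ∷ []

infixl 6 _+P_ _-P_
infixl 7 _*P_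

_+P_ : Poly → Poly → Poly
p +P r = p ++ r

-P_ : Poly → Poly
-P p = map (λ { (c , i , j) → (- c , i , j) }) p

_-P_ : Poly → Poly → Poly
p -P r = p +P (-P r)

_*P_ : Poly → Poly → Poly
p *P r = concatMap (λ { (c , i , j) → map (λ { (d , k , l) → (c *ℤ d , i + k , j + l) }) r }) p

δ : ℕ → Poly
δ zero = 1P
δ (suc _) = 0P

allᵇ : {A : Set} → (A → Bool) → List A → Bool
allᵇ p [] = true
allᵇ p (x ∷ xs) = p x ∧ allᵇ p xs

isEven : ℕ → Bool
isEven zero = true
isEven (suc zero) = false
isEven (suc (suc n)) = isEven n

-- evens m = (1 + q^2 + ... + q^(2m-2)) t
evens : ℕ → Poly
evens zero = []
evens (suc m) = evens m ++ ((1ℤ , 2 *ℕ m , 1) ∷ [])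

qtInt : ℕ → Poly
qtInt zero = []
qtInt (suc n) = if isEven (suc n)
                then evens ⌊ suc n /2⌋
                else (1ℤ , n , 0) ∷ evens ⌊ n /2⌋

allWords : ℕ → ℕ → List (List ℕ)
allWords zero L = [] ∷ []
allWords (suc n) L = concatMap (λ w → map (λ x → x ∷ w) (map suc (upTo L))) (allWords n L)

-- w_i ≤ max(w_1..w_{i-1}) + 1, m = running maximum
rgAux : ℕ → List ℕ → Bool
rgAux m [] = true
rgAux m (x ∷ xs) = (x ≤ᵇ suc m) ∧ rgAux (m ⊔ x) xs

isRG : List ℕ → Bool
isRG [] = false
isRG (x ∷ xs) = (x ≡ᵇ 1) ∧ rgAux x xs

maxL : List ℕ → ℕ
maxL = foldr _⊔_ 0

count : ℕ → List ℕ → ℕ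
count x [] = 0
count x (y ∷ ys) = (if x ≡ᵇ y then 1 else 0) + count x ys

evenOnce : List ℕ → Bool
evenOnce w = allᵇ (λ x → not (isEven x) ∨ (count x w ≡ᵇ 1)) w

inA : ℕ → ℕ → List ℕ → Bool
inA n k w = (length w ≡ᵇ n) ∧ isRG w ∧ (maxL w ≡ᵇ k) ∧ evenOnce w

-- statistics A and B; m = max(w_1..w_{i-1})
statA : ℕ → List ℕ → ℕ
statA m [] = 0
statA m (x ∷ xs) = (if x ≤ᵇ m then x ∸ 1 else 0) + statA (m ⊔ x) xs

statB : ℕ → List ℕ → ℕ
statB m [] = 0
statB m (x ∷ xs) = (if x <ᵇ m then 1 else 0) + statB (m ⊔ x) xs

Aw Bw : List ℕ → ℕ
Aw [] = 0
Aw (x ∷ xs) = statA x xs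
Bw [] = 0
Bw (x ∷ xs) = statB x xs

Sqt : ℕ → ℕ → Poly
Sqt zero zero = 1P
Sqt zero (suc k) = 0P
Sqt (suc n) k =
  map (λ w → (1ℤ , Aw w , Bw w)) (filterᵇ (inA (suc n) k) (allWords (suc n) (suc n)))

Square : Set
Square = ℕ × ℕ   -- (row i, column j)

shaded : ℕ → List Square
shaded n = filterᵇ (λ { (i , j) → ((i + j) ≤ᵇ n) ∧ isEven (n ∸ (i + j)) })
                   (concatMap (λ i → map (λ j → (i , j)) (map suc (upTo n))) (map suc (upTo n)))

sublists : {A : Set} → List A → List (List A)
sublists [] = [] ∷ []
sublists (x ∷ xs) = sublists xs ++ map (x ∷_) (sublists xs)

columnsDistinct : List Square → Bool
columnsDistinct [] = true
columnsDistinct ((i , j) ∷ T) = allᵇ (λ { (_ , j') → not (j ≡ᵇ j') }) T ∧ columnsDistinct T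

AR : ℕ → ℕ → List (List Square)
AR n r = filterᵇ (λ T → (length T ≡ᵇ r) ∧ columnsDistinct T) (sublists (shaded n))

below : ℕ → List Square → ℕ
below n [] = 0
below n ((i , j) ∷ T) = (n ∸ (i + j)) + below n T

nrow : List Square → ℕ
nrow [] = 0
nrow ((i , j) ∷ T) = (if i ≡ᵇ 1 then 0 else 1) + nrow T

sign : ℕ → ℤ
sign e = if isEven e then 1ℤ else -1ℤ

sqt : ℕ → ℕ → Poly
sqt zero zero = 1P
sqt zero (suc k) = 0P
sqt (suc n) k = if k ≤ᵇ suc n
  then map (λ T → (sign (suc n ∸ k) , below (suc n) T , nrow T)) (AR (suc n) (suc n ∸ k))
  else 0P

module Submission where

-- Both families are lists of monomials indexed by explicit finite sets
-- (RG-words, resp. rook placements), so every identity is proved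
-- coefficientwise: 'coeff p a b' becomes an integer sum over the index
-- list.
--
-- Second kind: a word of length n+2 is a word w of length n+1 followed by
-- a letter x.  If w is an RG-word with maximum M, then x = M+1 preserves
-- both statistics and raises the maximum, while an odd x ≤ M multiplies
-- the weight by q^(x-1) t^[x<M]; summing over x yields
-- S[n+1,k] + [k+1]·S[n+1,k+1].
--
-- First kind: the shaded board of length N+1 is, up to permutation, its
-- first column followed by a shifted copy of the board of length N.  A
-- placement has at most one rook in the first column, whose shaded squares
-- contribute exactly [N]_{q,t}; this yields the recurrence for s.

open import Defs
open import Data.Bool using (Bool; true; false; if_then_else_; _∧_; _∨_; not; T; T?)
open import Data.Bool.Properties using (∧-assoc; ∧-identityʳ; ∧-zeroʳ; ∨-zeroʳ; not-involutive; T-≡)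
open import Data.Empty using (⊥-elim)
open import Data.Integer using (ℤ; -_; 0ℤ; 1ℤ) renaming (_+_ to _+ℤ_; _*_ to _*ℤ_)
import Data.Integer.Properties as ℤP
open import Data.Integer.Tactic.RingSolver using (solve-∀)
open import Data.List using (List; []; _∷_; _++_; map; concatMap; filterᵇ; upTo; length; applyUpTo; [_])
open import Data.List.Properties
  using (length-map; map-++; filter-++; ++-identityʳ; concatMap-++; map-concatMap; map-applyUpTo; upTo-∷ʳ; concatMap-cong)
open import Data.List.Relation.Binary.Permutation.Propositional
  using (_↭_; prep; swap; ↭-trans; ↭-reflexive) renaming (refl to ↭-refl; trans to ↭-step)
open import Data.List.Relation.Binary.Permutation.Propositional.Properties
  using (↭-length; map⁺; shifts; ++⁺ˡ; filter-↭)
open import Data.List.Relation.Unary.All using (All; []; _∷_)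
open import Data.List.Relation.Unary.All.Properties using () renaming (++⁺ to All-++⁺; filter⁺ to All-filter⁺)
open import Data.Nat
  using (ℕ; zero; suc; _+_; _∸_; _⊔_; _≡ᵇ_; _≤ᵇ_; _<ᵇ_; ⌊_/2⌋; _≤_; _<_; z≤n; s≤s; s≤s⁻¹; ≤′-refl; ≤′-step)
  renaming (_*_ to _*ℕ_)
import Data.Nat.Properties as ℕP
open import Data.Nat.ListAction using (sum)
open import Data.Nat.ListAction.Properties using (sum-↭)
open import Data.Product using (_×_; _,_; proj₂; Σ)
open import Data.Sum using (_⊎_; inj₁; inj₂)
open import Function using (_∘_; _⟨_⟩_; Equivalence)
open import Relation.Binary.PropositionalEquality hiding ([_])

sumL : {A : Set} → (A → ℤ) → List A → ℤ
sumL f [] = 0ℤ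
sumL f (x ∷ xs) = f x +ℤ sumL f xs

sumN : (ℕ → ℤ) → ℕ → ℤ
sumN f zero = 0ℤ
sumN f (suc n) = sumN f n +ℤ f n

+-interchange : ∀ a b c d → (a +ℤ b) +ℤ (c +ℤ d) ≡ (a +ℤ c) +ℤ (b +ℤ d)
+-interchange = solve-∀

module _ {A : Set} where
  sumL-++ : (f : A → ℤ) (xs ys : List A) → sumL f (xs ++ ys) ≡ sumL f xs +ℤ sumL f ys
  sumL-++ f [] ys = sym (ℤP.+-identityˡ _)
  sumL-++ f (x ∷ xs) ys rewrite sumL-++ f xs ys = sym (ℤP.+-assoc (f x) _ _)

  sumL-ext : {f g : A → ℤ} → (∀ x → f x ≡ g x) → (xs : List A) → sumL f xs ≡ sumL g xs
  sumL-ext e [] = refl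
  sumL-ext e (x ∷ xs) = cong₂ _+ℤ_ (e x) (sumL-ext e xs)

  sumL-ext-All : (P : A → Set) {f g : A → ℤ} (xs : List A) → All P xs → (∀ x → P x → f x ≡ g x) →
                 sumL f xs ≡ sumL g xs
  sumL-ext-All P [] _ e = refl
  sumL-ext-All P (x ∷ xs) (px ∷ pxs) e = cong₂ _+ℤ_ (e x px) (sumL-ext-All P xs pxs e)

  sumL-zero : {f : A → ℤ} → (∀ x → f x ≡ 0ℤ) → (xs : List A) → sumL f xs ≡ 0ℤ
  sumL-zero e [] = refl
  sumL-zero e (x ∷ xs) rewrite e x | sumL-zero e xs = refl

  sumL-+ : (f g : A → ℤ) (xs : List A) → sumL (λ x → f x +ℤ g x) xs ≡ sumL f xs +ℤ sumL g xs
  sumL-+ f g [] = refl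
  sumL-+ f g (x ∷ xs) rewrite sumL-+ f g xs = +-interchange (f x) (g x) _ _

  sumL-scale : (c : ℤ) (f : A → ℤ) (xs : List A) → sumL (λ x → c *ℤ f x) xs ≡ c *ℤ sumL f xs
  sumL-scale c f [] = sym (ℤP.*-zeroʳ c)
  sumL-scale c f (x ∷ xs) rewrite sumL-scale c f xs = sym (ℤP.*-distribˡ-+ c (f x) _)

  sumL-if : (b : Bool) (f : A → ℤ) (xs : List A) →
            sumL (λ x → if b then f x else 0ℤ) xs ≡ (if b then sumL f xs else 0ℤ)
  sumL-if true f xs = refl
  sumL-if false f xs = sumL-zero (λ _ → refl) xs

  sumL-filter : (p : A → Bool) (f : A → ℤ) (xs : List A) →
                sumL f (filterᵇ p xs) ≡ sumL (λ x → if p x then f x else 0ℤ) xs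
  sumL-filter p f [] = refl
  sumL-filter p f (x ∷ xs) with p x
  ... | true = cong (f x +ℤ_) (sumL-filter p f xs)
  ... | false = sumL-filter p f xs ⟨ trans ⟩ sym (ℤP.+-identityˡ _)

module _ {A B : Set} where
  sumL-map : (f : B → ℤ) (g : A → B) (xs : List A) → sumL f (map g xs) ≡ sumL (f ∘ g) xs
  sumL-map f g [] = refl
  sumL-map f g (x ∷ xs) = cong (f (g x) +ℤ_) (sumL-map f g xs)

  sumL-concatMap : (f : B → ℤ) (g : A → List B) (xs : List A) →
                   sumL f (concatMap g xs) ≡ sumL (λ x → sumL f (g x)) xs
  sumL-concatMap f g [] = refl
  sumL-concatMap f g (x ∷ xs) =
    sumL-++ f (g x) (concatMap g xs) ⟨ trans ⟩ cong (sumL f (g x) +ℤ_) (sumL-concatMap f g xs)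

  sumL-swap : (f : A → B → ℤ) (xs : List A) (ys : List B) →
              sumL (λ x → sumL (f x) ys) xs ≡ sumL (λ y → sumL (λ x → f x y) xs) ys
  sumL-swap f [] ys = sym (sumL-zero (λ _ → refl) ys)
  sumL-swap f (x ∷ xs) ys rewrite sumL-swap f xs ys = sym (sumL-+ (f x) (λ y → sumL (λ x → f x y) xs) ys)

sumN-ext : {f g : ℕ → ℤ} (n : ℕ) → (∀ i → i < n → f i ≡ g i) → sumN f n ≡ sumN g n
sumN-ext zero e = refl
sumN-ext (suc n) e = cong₂ _+ℤ_ (sumN-ext n (λ i i<n → e i (ℕP.m<n⇒m<1+n i<n))) (e n ℕP.≤-refl)

sumN-+ : (f g : ℕ → ℤ) (n : ℕ) → sumN (λ i → f i +ℤ g i) n ≡ sumN f n +ℤ sumN g n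
sumN-+ f g zero = refl
sumN-+ f g (suc n) rewrite sumN-+ f g n = +-interchange (sumN f n) (sumN g n) (f n) (g n)

sumN-zero : {f : ℕ → ℤ} (n : ℕ) → (∀ i → i < n → f i ≡ 0ℤ) → sumN f n ≡ 0ℤ
sumN-zero n e = sumN-ext n e ⟨ trans ⟩ zeros n
  where
  zeros : ∀ n → sumN (λ _ → 0ℤ) n ≡ 0ℤ
  zeros zero = refl
  zeros (suc n) rewrite zeros n = refl

sumN-head : (f : ℕ → ℤ) (n : ℕ) → sumN f (suc n) ≡ f 0 +ℤ sumN (f ∘ suc) n
sumN-head f zero = ℤP.+-comm 0ℤ (f 0)
sumN-head f (suc n) rewrite sumN-head f n = ℤP.+-assoc (f 0) _ _

sumN-reverse : (f : ℕ → ℤ) (n : ℕ) → sumN f n ≡ sumN (λ d → f (n ∸ suc d)) n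
sumN-reverse f zero = refl
sumN-reverse f (suc n) = begin
  sumN f n +ℤ f n                       ≡⟨ cong (_+ℤ f n) (sumN-reverse f n) ⟩
  sumN (λ d → f (n ∸ suc d)) n +ℤ f n   ≡⟨ ℤP.+-comm _ (f n) ⟩
  f n +ℤ sumN (λ d → f (n ∸ suc d)) n   ≡⟨ sym (sumN-head (λ d → f (n ∸ d)) n) ⟩
  sumN (λ d → f (suc n ∸ suc d)) (suc n) ∎
  where open ≡-Reasoning

sumN-swap : (f : ℕ → ℕ → ℤ) (m n : ℕ) → sumN (λ i → sumN (f i) n) m ≡ sumN (λ j → sumN (λ i → f i j) m) n
sumN-swap f zero n = sym (sumN-zero n (λ _ _ → refl))
sumN-swap f (suc m) n rewrite sumN-swap f m n = sym (sumN-+ (λ j → sumN (λ i → f i j) m) (f m) n)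

sumN-truncate : {f : ℕ → ℤ} (K N : ℕ) → (∀ i → K ≤ i → f i ≡ 0ℤ) → K ≤ N → sumN f N ≡ sumN f K
sumN-truncate {f} K N e K≤N with ℕP.≤⇒≤′ K≤N
... | ≤′-refl = refl
... | ≤′-step {n = N'} K≤′N' =
  cong₂ _+ℤ_ (sumN-truncate K N' e (ℕP.≤′⇒≤ K≤′N')) (e N' (ℕP.≤′⇒≤ K≤′N')) ⟨ trans ⟩ ℤP.+-identityʳ _

sumL-applyUpTo : (f : ℕ → ℤ) (g : ℕ → ℕ) (n : ℕ) → sumL f (applyUpTo g n) ≡ sumN (f ∘ g) n
sumL-applyUpTo f g zero = refl
sumL-applyUpTo f g (suc n) rewrite sumL-applyUpTo f (g ∘ suc) n = sym (sumN-head (f ∘ g) n)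

sumL-upTo : (f : ℕ → ℤ) (n : ℕ) → sumL f (upTo n) ≡ sumN f n
sumL-upTo f n = sumL-applyUpTo f (λ x → x) n

T⇒≡true : ∀ {b} → T b → b ≡ true
T⇒≡true = Equivalence.to T-≡

≡true⇒T : ∀ {b} → b ≡ true → T b
≡true⇒T = Equivalence.from T-≡

false≢true : false ≢ true
false≢true ()

∧-true : ∀ {p q} → (p ∧ q) ≡ true → (p ≡ true) × (q ≡ true)
∧-true {true} {true} _ = refl , refl

≤ᵇ-true : ∀ {m n} → m ≤ n → (m ≤ᵇ n) ≡ true
≤ᵇ-true p = T⇒≡true (ℕP.≤⇒≤ᵇ p)

≤ᵇ-false : ∀ {m n} → n < m → (m ≤ᵇ n) ≡ false
≤ᵇ-false {m} {n} p with m ≤ᵇ n in eq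
... | true = ⊥-elim (ℕP.<⇒≱ p (ℕP.≤ᵇ⇒≤ m n (≡true⇒T eq)))
... | false = refl

≤ᵇ-sound : ∀ m n → (m ≤ᵇ n) ≡ true → m ≤ n
≤ᵇ-sound m n e = ℕP.≤ᵇ⇒≤ m n (≡true⇒T e)

<ᵇ-true : ∀ {m n} → m < n → (m <ᵇ n) ≡ true
<ᵇ-true p = T⇒≡true (ℕP.<⇒<ᵇ p)

<ᵇ-false : ∀ {m n} → n ≤ m → (m <ᵇ n) ≡ false
<ᵇ-false {m} {n} p with m <ᵇ n in eq
... | true = ⊥-elim (ℕP.<⇒≱ (ℕP.<ᵇ⇒< m n (≡true⇒T eq)) p)
... | false = refl

≡ᵇ-true : ∀ {m n} → m ≡ n → (m ≡ᵇ n) ≡ true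
≡ᵇ-true {m} refl = T⇒≡true (ℕP.≡⇒≡ᵇ m m refl)

≡ᵇ-false : ∀ {m n} → m ≢ n → (m ≡ᵇ n) ≡ false
≡ᵇ-false {m} {n} p with m ≡ᵇ n in eq
... | true = ⊥-elim (p (ℕP.≡ᵇ⇒≡ m n (≡true⇒T eq)))
... | false = refl

≡ᵇ-sound : ∀ m n → (m ≡ᵇ n) ≡ true → m ≡ n
≡ᵇ-sound m n e = ℕP.≡ᵇ⇒≡ m n (≡true⇒T e)

≡ᵇ-sym : ∀ m n → (m ≡ᵇ n) ≡ (n ≡ᵇ m)
≡ᵇ-sym zero zero = refl
≡ᵇ-sym zero (suc n) = refl
≡ᵇ-sym (suc m) zero = refl
≡ᵇ-sym (suc m) (suc n) = ≡ᵇ-sym m n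

isEven-suc : ∀ x → isEven (suc x) ≡ not (isEven x)
isEven-suc zero = refl
isEven-suc (suc zero) = refl
isEven-suc (suc (suc x)) = isEven-suc x

Mono : Set
Mono = ℤ × ℕ × ℕ

coeffMono : Mono → ℕ → ℕ → ℤ
coeffMono (c , i , j) a b = if (a ≡ᵇ i) ∧ (b ≡ᵇ j) then c else 0ℤ

mulMono : Mono → Mono → Mono
mulMono (c , i , j) (d , k , l) = (c *ℤ d , i + k , j + l)

coeffTimes : Poly → ℕ → ℕ → ℕ → ℕ → ℤ
coeffTimes p A B a b = sumL (λ m → coeffMono (mulMono m (1ℤ , A , B)) a b) p

coeff-sum : ∀ p a b → coeff p a b ≡ sumL (λ m → coeffMono m a b) p
coeff-sum [] a b = refl
coeff-sum ((c , i , j) ∷ p) a b = cong (coeffMono (c , i , j) a b +ℤ_) (coeff-sum p a b)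

coeff-+P : ∀ p r a b → coeff (p +P r) a b ≡ coeff p a b +ℤ coeff r a b
coeff-+P p r a b = begin
  coeff (p ++ r) a b                                          ≡⟨ coeff-sum (p ++ r) a b ⟩
  sumL (λ m → coeffMono m a b) (p ++ r)                        ≡⟨ sumL-++ _ p r ⟩
  sumL (λ m → coeffMono m a b) p +ℤ sumL (λ m → coeffMono m a b) r
    ≡⟨ sym (cong₂ _+ℤ_ (coeff-sum p a b) (coeff-sum r a b)) ⟩
  coeff p a b +ℤ coeff r a b                                  ∎
  where open ≡-Reasoning

coeff--P : ∀ p a b → coeff (-P p) a b ≡ - coeff p a b
coeff--P [] a b = refl
coeff--P ((c , i , j) ∷ p) a b with (a ≡ᵇ i) ∧ (b ≡ᵇ j)
... | true = cong (- c +ℤ_) (coeff--P p a b) ⟨ trans ⟩ sym (ℤP.neg-distrib-+ c _)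
... | false = ℤP.+-identityˡ _ ⟨ trans ⟩ (coeff--P p a b ⟨ trans ⟩ sym (cong -_ (ℤP.+-identityˡ _)))

coeff-*P : ∀ p r a b → coeff (p *P r) a b ≡ sumL (λ m → sumL (λ m' → coeffMono (mulMono m m') a b) r) p
coeff-*P p r a b = begin
  coeff (p *P r) a b                                      ≡⟨ coeff-sum (p *P r) a b ⟩
  sumL (λ m → coeffMono m a b) (p *P r)                    ≡⟨ sumL-concatMap (λ m → coeffMono m a b) _ p ⟩
  sumL (λ m → sumL (λ m → coeffMono m a b) (map (mulMono m) r)) p
    ≡⟨ sumL-ext (λ m → sumL-map (λ m → coeffMono m a b) (mulMono m) r) p ⟩
  sumL (λ m → sumL (λ m' → coeffMono (mulMono m m') a b) r) p ∎
  where open ≡-Reasoning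

coeff-map-filter : {A : Set} (g : A → Mono) (p : A → Bool) (xs : List A) (a b : ℕ) →
  coeff (map g (filterᵇ p xs)) a b ≡ sumL (λ x → if p x then coeffMono (g x) a b else 0ℤ) xs
coeff-map-filter g p xs a b =
  coeff-sum (map g (filterᵇ p xs)) a b ⟨ trans ⟩
  (sumL-map (λ m → coeffMono m a b) g (filterᵇ p xs) ⟨ trans ⟩ sumL-filter p _ xs)

coeffMono-scale : ∀ s I J a b → coeffMono (s , I , J) a b ≡ s *ℤ coeffMono (1ℤ , I , J) a b
coeffMono-scale s I J a b with (a ≡ᵇ I) ∧ (b ≡ᵇ J)
... | true = sym (ℤP.*-identityʳ s)
... | false = sym (ℤP.*-zeroʳ s)

if-scale : ∀ (c : Bool) s x → (if c then s *ℤ x else 0ℤ) ≡ s *ℤ (if c then x else 0ℤ)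
if-scale true s x = refl
if-scale false s x = sym (ℤP.*-zeroʳ s)

coeff-scaled-filter : {A : Set} (p : A → Bool) (xs : List A) (s : ℤ) (e f : A → ℕ) (a b : ℕ) →
  coeff (map (λ x → (s , e x , f x)) (filterᵇ p xs)) a b
    ≡ s *ℤ sumL (λ x → if p x then coeffMono (1ℤ , e x , f x) a b else 0ℤ) xs
coeff-scaled-filter p xs s e f a b =
  coeff-map-filter _ p xs a b ⟨ trans ⟩
  (sumL-ext (λ x → cong (λ z → if p x then z else 0ℤ) (coeffMono-scale s _ _ a b) ⟨ trans ⟩ if-scale (p x) s _) xs
   ⟨ trans ⟩ sumL-scale s _ xs)

*-unit-commute : ∀ c s → c *ℤ s ≡ s *ℤ (c *ℤ 1ℤ)
*-unit-commute = solve-∀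

coeffMono-factor : ∀ c s I J a b → coeffMono (c *ℤ s , I , J) a b ≡ s *ℤ coeffMono (c *ℤ 1ℤ , I , J) a b
coeffMono-factor c s I J a b with (a ≡ᵇ I) ∧ (b ≡ᵇ J)
... | true = *-unit-commute c s
... | false = sym (ℤP.*-zeroʳ s)

coeff-times-scaled-filter : {A : Set} (qt : Poly) (p : A → Bool) (xs : List A) (s : ℤ) (e f : A → ℕ) (a b : ℕ) →
  coeff (qt *P map (λ x → (s , e x , f x)) (filterᵇ p xs)) a b
    ≡ s *ℤ sumL (λ x → if p x then coeffTimes qt (e x) (f x) a b else 0ℤ) xs
coeff-times-scaled-filter qt p xs s e f a b = begin
  coeff (qt *P map h (filterᵇ p xs)) a b ≡⟨ coeff-*P qt _ a b ⟩
  sumL (λ m → sumL (λ m' → coeffMono (mulMono m m') a b) (map h (filterᵇ p xs))) qt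
    ≡⟨ sumL-ext (λ m → sumL-map (λ m' → coeffMono (mulMono m m') a b) h (filterᵇ p xs)
                        ⟨ trans ⟩ sumL-filter p _ xs) qt ⟩
  sumL (λ m → sumL (λ x → if p x then coeffMono (mulMono m (h x)) a b else 0ℤ) xs) qt
    ≡⟨ sumL-swap _ qt xs ⟩
  sumL (λ x → sumL (λ m → if p x then coeffMono (mulMono m (h x)) a b else 0ℤ) qt) xs
    ≡⟨ sumL-ext (λ x → sumL-if (p x) _ qt ⟨ trans ⟩ cong (λ z → if p x then z else 0ℤ) (factor x)
                        ⟨ trans ⟩ if-scale (p x) s _) xs ⟩
  sumL (λ x → s *ℤ (if p x then coeffTimes qt (e x) (f x) a b else 0ℤ)) xs
    ≡⟨ sumL-scale s _ xs ⟩
  s *ℤ sumL (λ x → if p x then coeffTimes qt (e x) (f x) a b else 0ℤ) xs ∎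
  where
  open ≡-Reasoning
  h = λ x → (s , e x , f x)
  factor : ∀ x → sumL (λ m → coeffMono (mulMono m (h x)) a b) qt ≡ s *ℤ coeffTimes qt (e x) (f x) a b
  factor x = sumL-ext (λ { (c , i , j) → coeffMono-factor c s (i + e x) (j + f x) a b }) qt ⟨ trans ⟩ sumL-scale s _ qt

qtIntSum : ℕ → ℕ → ℕ → ℕ → ℕ → ℤ
qtIntSum k A B a b =
  sumN (λ i → if isEven i then coeffMono (1ℤ , i + A , (if suc i <ᵇ k then 1 else 0) + B) a b else 0ℤ) k

evensSum : ℕ → ℕ → ℕ → ℕ → ℕ → ℤ
evensSum k A B a b = sumN (λ i → if isEven i then coeffMono (1ℤ , i + A , 1 + B) a b else 0ℤ) k

isEven-double : ∀ m → isEven (2 *ℕ m) ≡ true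
isEven-double zero = refl
isEven-double (suc m) rewrite ℕP.+-suc m (m + 0) = isEven-double m

half-double : ∀ m → ⌊ 2 *ℕ m /2⌋ ≡ m
half-double zero = refl
half-double (suc m) rewrite ℕP.+-suc m (m + 0) = cong suc (half-double m)

parity : ∀ k → Σ ℕ (λ m → (k ≡ 2 *ℕ m) ⊎ (k ≡ suc (2 *ℕ m)))
parity zero = 0 , inj₁ refl
parity (suc k) with parity k
... | m , inj₁ e = m , inj₂ (cong suc e)
... | m , inj₂ e = suc m , inj₁ (cong suc e ⟨ trans ⟩ sym (ℕP.*-suc 2 m))

qtInt-even : ∀ m → qtInt (2 *ℕ m) ≡ evens m
qtInt-even zero = refl
qtInt-even (suc m) rewrite ℕP.+-suc m (m + 0) | isEven-double m | half-double m = refl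

qtInt-odd : ∀ m → qtInt (suc (2 *ℕ m)) ≡ (1ℤ , 2 *ℕ m , 0) ∷ evens m
qtInt-odd m rewrite isEven-suc (2 *ℕ m) | isEven-double m | half-double m = refl

coeffTimes-evens : ∀ m A B a b → coeffTimes (evens m) A B a b ≡ evensSum (2 *ℕ m) A B a b
coeffTimes-evens zero A B a b = refl
coeffTimes-evens (suc m) A B a b
  rewrite ℕP.+-suc m (m + 0) | sumL-++ (λ m' → coeffMono (mulMono m' (1ℤ , A , B)) a b) (evens m) ((1ℤ , 2 *ℕ m , 1) ∷ [])
        | coeffTimes-evens m A B a b | isEven-suc (2 *ℕ m) | isEven-double m =
  cong (evensSum (2 *ℕ m) A B a b +ℤ_) (ℤP.+-identityʳ c) ⟨ trans ⟩ sym (ℤP.+-identityʳ (evensSum (2 *ℕ m) A B a b +ℤ c))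
  where
  c = coeffMono (1ℤ , 2 *ℕ m + A , 1 + B) a b

even-step : ∀ i m → isEven i ≡ true → i < 2 *ℕ m → suc i < 2 *ℕ m
even-step i m ei i< = ℕP.≤∧≢⇒< i< (λ e → false≢true
  (sym (isEven-suc i ⟨ trans ⟩ cong not ei) ⟨ trans ⟩ (cong isEven e ⟨ trans ⟩ isEven-double m)))

-- [k]_{q,t} = Σ_{i<k, i even} q^i t^[i+1<k]: for even k every term carries t,
-- for odd k exactly the top term q^(k-1) does not.
coeffTimes-qtInt : ∀ k A B a b → coeffTimes (qtInt k) A B a b ≡ qtIntSum k A B a b
coeffTimes-qtInt k A B a b with parity k
... | m , inj₁ refl rewrite qtInt-even m | coeffTimes-evens m A B a b = sumN-ext (2 *ℕ m) allWithT
  where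
  allWithT : ∀ i → i < 2 *ℕ m →
    (if isEven i then coeffMono (1ℤ , i + A , 1 + B) a b else 0ℤ)
      ≡ (if isEven i then coeffMono (1ℤ , i + A , (if suc i <ᵇ 2 *ℕ m then 1 else 0) + B) a b else 0ℤ)
  allWithT i i< with isEven i in ei
  ... | false = refl
  ... | true rewrite <ᵇ-true (even-step i m ei i<) = refl
... | m , inj₂ refl rewrite qtInt-odd m | coeffTimes-evens m A B a b | isEven-double m | <ᵇ-false {2 *ℕ m} {2 *ℕ m} ℕP.≤-refl =
  ℤP.+-comm top (evensSum (2 *ℕ m) A B a b) ⟨ trans ⟩ cong (_+ℤ top) (sumN-ext (2 *ℕ m) belowTop)
  where
  top = coeffMono (1ℤ , 2 *ℕ m + A , B) a b
  belowTop : ∀ i → i < 2 *ℕ m →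
    (if isEven i then coeffMono (1ℤ , i + A , 1 + B) a b else 0ℤ)
      ≡ (if isEven i then coeffMono (1ℤ , i + A , (if suc i <ᵇ suc (2 *ℕ m) then 1 else 0) + B) a b else 0ℤ)
  belowTop i i< rewrite <ᵇ-true {i} {2 *ℕ m} i< = refl

-- Words: effect of appending a letter x to a word w.

len-snoc : ∀ (ys : List ℕ) x → length (ys ++ [ x ]) ≡ suc (length ys)
len-snoc [] x = refl
len-snoc (y ∷ ys) x = cong suc (len-snoc ys x)

maxL-snoc : ∀ ys x → maxL (ys ++ [ x ]) ≡ maxL ys ⊔ x
maxL-snoc [] x = ℕP.⊔-identityʳ x
maxL-snoc (y ∷ ys) x rewrite maxL-snoc ys x = sym (ℕP.⊔-assoc y (maxL ys) x)

rgAux-snoc : ∀ m ys x → rgAux m (ys ++ [ x ]) ≡ rgAux m ys ∧ (x ≤ᵇ suc (m ⊔ maxL ys))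
rgAux-snoc m [] x rewrite ℕP.⊔-identityʳ m = ∧-identityʳ _
rgAux-snoc m (y ∷ ys) x rewrite rgAux-snoc (m ⊔ y) ys x | ℕP.⊔-assoc m y (maxL ys) =
  sym (∧-assoc (y ≤ᵇ suc m) _ _)

statA-snoc : ∀ m ys x → statA m (ys ++ [ x ]) ≡ statA m ys + (if x ≤ᵇ m ⊔ maxL ys then x ∸ 1 else 0)
statA-snoc m [] x rewrite ℕP.⊔-identityʳ m = ℕP.+-identityʳ _
statA-snoc m (y ∷ ys) x rewrite statA-snoc (m ⊔ y) ys x | ℕP.⊔-assoc m y (maxL ys) =
  sym (ℕP.+-assoc (if y ≤ᵇ m then y ∸ 1 else 0) _ _)

statB-snoc : ∀ m ys x → statB m (ys ++ [ x ]) ≡ statB m ys + (if x <ᵇ m ⊔ maxL ys then 1 else 0)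
statB-snoc m [] x rewrite ℕP.⊔-identityʳ m = ℕP.+-identityʳ _
statB-snoc m (y ∷ ys) x rewrite statB-snoc (m ⊔ y) ys x | ℕP.⊔-assoc m y (maxL ys) =
  sym (ℕP.+-assoc (if y <ᵇ m then 1 else 0) _ _)

count-snoc : ∀ z ys x → count z (ys ++ [ x ]) ≡ count z ys + (if z ≡ᵇ x then 1 else 0)
count-snoc z [] x = ℕP.+-identityʳ _
count-snoc z (y ∷ ys) x rewrite count-snoc z ys x = sym (ℕP.+-assoc (if z ≡ᵇ y then 1 else 0) _ _)

count-above : ∀ z ys → maxL ys < z → count z ys ≡ 0
count-above z [] p = refl
count-above z (y ∷ ys) p rewrite ≡ᵇ-false {z} {y} (λ e → ℕP.<-irrefl (sym e) (ℕP.m⊔n<o⇒m<o y _ p)) =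
  count-above z ys (ℕP.m⊔n<o⇒n<o y _ p)

rg-max : ∀ m ys → rgAux m ys ≡ true → maxL ys ≤ m + length ys
rg-max m [] e = z≤n
rg-max m (y ∷ ys) e with ∧-true {y ≤ᵇ suc m} e
... | e1 , e2 rewrite ℕP.+-suc m (length ys) = ℕP.⊔-lub yBound restBound
  where
  y≤ : y ≤ suc m
  y≤ = ≤ᵇ-sound y (suc m) e1
  yBound : y ≤ suc (m + length ys)
  yBound = ℕP.≤-trans y≤ (s≤s (ℕP.m≤m+n m _))
  restBound : maxL ys ≤ suc (m + length ys)
  restBound = ℕP.≤-trans (rg-max (m ⊔ y) ys e2) (ℕP.+-monoˡ-≤ (length ys) (ℕP.⊔-lub (ℕP.n≤1+n m) y≤))

rg-contains : ∀ m ys z → rgAux m ys ≡ true → m < z → z ≤ maxL ys → 1 ≤ count z ys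
rg-contains m [] z e m<z z≤ = ⊥-elim (ℕP.<⇒≱ (ℕP.≤-<-trans z≤n m<z) z≤)
rg-contains m (y ∷ ys) z e m<z z≤ with ∧-true {y ≤ᵇ suc m} e | z ≡ᵇ y in ez
... | _ | true = s≤s z≤n
... | e1 , e2 | false = rg-contains (m ⊔ y) ys z e2 (ℕP.⊔-lub m<z y<z) z≤rest
  where
  y<z : y < z
  y<z = ℕP.≤∧≢⇒< (ℕP.≤-trans (≤ᵇ-sound y (suc m) e1) m<z)
                  (λ p → false≢true (trans (sym ez) (≡ᵇ-true {z} {y} (sym p))))
  z≤rest : z ≤ maxL ys
  z≤rest with ℕP.≤-total y (maxL ys)
  ... | inj₁ p = subst (z ≤_) (ℕP.m≤n⇒m⊔n≡n p) z≤
  ... | inj₂ p = ⊥-elim (ℕP.<⇒≱ y<z (subst (z ≤_) (ℕP.m≥n⇒m⊔n≡m p) z≤))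

rg-occurs : ∀ w z → isRG w ≡ true → 1 ≤ z → z ≤ maxL w → 1 ≤ count z w
rg-occurs (y ∷ ys) z e 1≤z z≤ with ∧-true {y ≡ᵇ 1} e
... | e1 , e2 with ≡ᵇ-sound y 1 e1
... | refl = rg-contains 0 (1 ∷ ys) z e2 1≤z z≤

allᵇ-snoc : ∀ {A : Set} (p : A → Bool) ys x → allᵇ p (ys ++ [ x ]) ≡ allᵇ p ys ∧ (p x ∧ true)
allᵇ-snoc p [] x = refl
allᵇ-snoc p (y ∷ ys) x rewrite allᵇ-snoc p ys x = sym (∧-assoc (p y) _ _)

allᵇ-ext : ∀ {A : Set} {p q : A → Bool} → (∀ z → p z ≡ q z) → ∀ ys → allᵇ p ys ≡ allᵇ q ys
allᵇ-ext e [] = refl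
allᵇ-ext e (y ∷ ys) = cong₂ _∧_ (e y) (allᵇ-ext e ys)

allᵇ-ext-below : ∀ {p q : ℕ → Bool} B → (∀ z → z ≤ B → p z ≡ q z) →
                 ∀ ys → maxL ys ≤ B → allᵇ p ys ≡ allᵇ q ys
allᵇ-ext-below B e [] _ = refl
allᵇ-ext-below B e (y ∷ ys) le =
  cong₂ _∧_ (e y (ℕP.m⊔n≤o⇒m≤o y _ le)) (allᵇ-ext-below B e ys (ℕP.m⊔n≤o⇒n≤o y _ le))

evenOnce-newMax : ∀ w → evenOnce (w ++ [ suc (maxL w) ]) ≡ evenOnce w
evenOnce-newMax w = begin
  allᵇ P' (w ++ [ x ])        ≡⟨ allᵇ-snoc P' w x ⟩
  allᵇ P' w ∧ (P' x ∧ true)   ≡⟨ cong₂ (λ u v → u ∧ (v ∧ true)) (allᵇ-ext-below (maxL w) old w ℕP.≤-refl) new ⟩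
  allᵇ P w ∧ (true ∧ true)    ≡⟨ ∧-identityʳ _ ⟩
  allᵇ P w                    ∎
  where
  open ≡-Reasoning
  x = suc (maxL w)
  P' = λ z → not (isEven z) ∨ (count z (w ++ [ x ]) ≡ᵇ 1)
  P = λ z → not (isEven z) ∨ (count z w ≡ᵇ 1)
  old : ∀ z → z ≤ maxL w → P' z ≡ P z
  old z z≤ rewrite count-snoc z w x | ≡ᵇ-false {z} {x} (λ e → ℕP.<-irrefl e (s≤s z≤)) | ℕP.+-identityʳ (count z w) = refl
  new : P' x ≡ true
  new rewrite count-snoc x w x | ≡ᵇ-true {x} refl | count-above x w ℕP.≤-refl = ∨-zeroʳ _

evenOnce-oldLetter : ∀ w x → isRG w ≡ true → 1 ≤ x → x ≤ maxL w →
                     evenOnce (w ++ [ x ]) ≡ evenOnce w ∧ not (isEven x)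
evenOnce-oldLetter w x rg 1≤x x≤ with isEven x in ex
... | true = begin
  allᵇ P' (w ++ [ x ])        ≡⟨ allᵇ-snoc P' w x ⟩
  allᵇ P' w ∧ (P' x ∧ true)   ≡⟨ cong (λ v → allᵇ P' w ∧ (v ∧ true)) repeated ⟩
  allᵇ P' w ∧ false           ≡⟨ ∧-zeroʳ _ ⟩
  false                       ≡⟨ sym (∧-zeroʳ _) ⟩
  allᵇ P w ∧ false            ∎
  where
  open ≡-Reasoning
  P' = λ z → not (isEven z) ∨ (count z (w ++ [ x ]) ≡ᵇ 1)
  P = λ z → not (isEven z) ∨ (count z w ≡ᵇ 1)
  repeated : P' x ≡ false
  repeated rewrite count-snoc x w x | ≡ᵇ-true {x} refl | ex with count x w | rg-occurs w x rg 1≤x x≤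
  ... | suc c | _ rewrite ℕP.+-comm c 1 = refl
... | false = begin
  allᵇ P' (w ++ [ x ])        ≡⟨ allᵇ-snoc P' w x ⟩
  allᵇ P' w ∧ (P' x ∧ true)   ≡⟨ cong₂ (λ u v → u ∧ (v ∧ true)) (allᵇ-ext others w) odd ⟩
  allᵇ P w ∧ (true ∧ true)    ∎
  where
  open ≡-Reasoning
  P' = λ z → not (isEven z) ∨ (count z (w ++ [ x ]) ≡ᵇ 1)
  P = λ z → not (isEven z) ∨ (count z w ≡ᵇ 1)
  odd : P' x ≡ true
  odd rewrite ex = refl
  others : ∀ z → P' z ≡ P z
  others z rewrite count-snoc z w x with z ≡ᵇ x in ezx
  ... | false rewrite ℕP.+-identityʳ (count z w) = refl
  ... | true with ≡ᵇ-sound z x ezx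
  ... | refl rewrite ex = refl

sumWords : ℕ → ℕ → (List ℕ → ℤ) → ℤ
sumWords n L f = sumL f (allWords n L)

sumWords-cons : ∀ n L f → sumWords (suc n) L f ≡ sumWords n L (λ w → sumN (λ i → f (suc i ∷ w)) L)
sumWords-cons n L f =
  sumL-concatMap f _ (allWords n L) ⟨ trans ⟩
  sumL-ext (λ w → sumL-map f (λ x → x ∷ w) (map suc (upTo L)) ⟨ trans ⟩
                  (sumL-map _ suc (upTo L) ⟨ trans ⟩ sumL-upTo _ L)) (allWords n L)

sumWords-ext : ∀ n L {f g} → (∀ w → f w ≡ g w) → sumWords n L f ≡ sumWords n L g
sumWords-ext n L e = sumL-ext e (allWords n L)

sumWords-shrink : ∀ n L f → (∀ w → L < maxL w → f w ≡ 0ℤ) → sumWords n (suc L) f ≡ sumWords n L f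
sumWords-shrink zero L f e = refl
sumWords-shrink (suc n) L f e = begin
  sumWords (suc n) (suc L) f
    ≡⟨ sumWords-cons n (suc L) f ⟩
  sumWords n (suc L) (λ w → sumN (λ i → f (suc i ∷ w)) L +ℤ f (suc L ∷ w))
    ≡⟨ sumWords-ext n (suc L) (λ w → cong (g w +ℤ_) (e (suc L ∷ w) (ℕP.m≤m⊔n (suc L) (maxL w))) ⟨ trans ⟩ ℤP.+-identityʳ _) ⟩
  sumWords n (suc L) g
    ≡⟨ sumWords-shrink n L g (λ w p → sumN-zero L (λ i _ → e (suc i ∷ w) (ℕP.<-≤-trans p (ℕP.m≤n⊔m (suc i) (maxL w))))) ⟩
  sumWords n L g
    ≡⟨ sym (sumWords-cons n L f) ⟩
  sumWords (suc n) L f ∎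
  where
  open ≡-Reasoning
  g = λ w → sumN (λ i → f (suc i ∷ w)) L

sumWords-snoc : ∀ n L f → sumWords (suc n) L f ≡ sumWords n L (λ w → sumN (λ i → f (w ++ [ suc i ])) L)
sumWords-snoc zero L f = sumWords-cons zero L f
sumWords-snoc (suc n) L f = begin
  sumWords (suc (suc n)) L f
    ≡⟨ sumWords-cons (suc n) L f ⟩
  sumWords (suc n) L g
    ≡⟨ sumWords-snoc n L g ⟩
  sumWords n L (λ w → sumN (λ j → sumN (λ i → f (suc i ∷ (w ++ [ suc j ]))) L) L)
    ≡⟨ sumWords-ext n L (λ w → sumN-swap (λ j i → f (suc i ∷ (w ++ [ suc j ]))) L L) ⟩
  sumWords n L (λ w → sumN (λ i → sumN (λ j → f (suc i ∷ w ++ [ suc j ])) L) L)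
    ≡⟨ sym (sumWords-cons n L _) ⟩
  sumWords (suc n) L (λ w → sumN (λ i → f (w ++ [ suc i ])) L) ∎
  where
  open ≡-Reasoning
  g = λ w → sumN (λ i → f (suc i ∷ w)) L

wordTerm : ℕ → ℕ → ℕ → ℕ → List ℕ → ℤ
wordTerm n k a b w = if inA n k w then coeffMono (1ℤ , Aw w , Bw w) a b else 0ℤ

Sqt-coeff : ∀ n k a b → coeff (Sqt (suc n) k) a b ≡ sumWords (suc n) (suc n) (wordTerm (suc n) k a b)
Sqt-coeff n k a b = coeff-map-filter _ (inA (suc n) k) (allWords (suc n) (suc n)) a b

inA-max : ∀ n k w → inA n k w ≡ true → maxL w ≤ n
inA-max n k [] e with ∧-true {0 ≡ᵇ n} e
... | _ , ()
inA-max n k (y ∷ ys) e with ∧-true {length (y ∷ ys) ≡ᵇ n} e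
... | e3 , r with ∧-true {isRG (y ∷ ys)} r
... | rg , _ with ∧-true {y ≡ᵇ 1} rg
... | e1 , e2 with ≡ᵇ-sound y 1 e1 | ≡ᵇ-sound (length (y ∷ ys)) n e3
... | refl | refl = ℕP.⊔-lub (s≤s z≤n) (rg-max 1 ys e2)

-- The pure sum identity behind the last-letter analysis: the letters below
-- a maximum M = k+1 produce exactly qtIntSum (k+1), the new maximum the rest.
assembleLastLetter : ∀ (a b M k A B : ℕ) (eo : Bool) →
  sumN (λ i → if (M ≡ᵇ suc k) ∧ (eo ∧ isEven i)
              then coeffMono (1ℤ , A + i , B + (if suc i <ᵇ M then 1 else 0)) a b else 0ℤ) M
    +ℤ (if (M ≡ᵇ k) ∧ eo then coeffMono (1ℤ , A + 0 , B + 0) a b else 0ℤ)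
  ≡ (if (M ≡ᵇ k) ∧ eo then coeffMono (1ℤ , A , B) a b else 0ℤ)
    +ℤ (if (M ≡ᵇ suc k) ∧ eo then qtIntSum (suc k) A B a b else 0ℤ)
assembleLastLetter a b M k A B eo rewrite ℕP.+-identityʳ A | ℕP.+-identityʳ B with M ≡ᵇ suc k in M≡k+1 | eo
... | false | e rewrite sumN-zero {λ i → 0ℤ} M (λ _ _ → refl) = ℤP.+-identityˡ X ⟨ trans ⟩ sym (ℤP.+-identityʳ X)
  where
  X = if (M ≡ᵇ k) ∧ e then coeffMono (1ℤ , A , B) a b else 0ℤ
... | true | false rewrite ∧-zeroʳ (M ≡ᵇ k) | sumN-zero {λ i → 0ℤ} M (λ _ _ → refl) = refl
... | true | true with ≡ᵇ-sound M (suc k) M≡k+1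
... | refl rewrite ≡ᵇ-false {suc k} {k} (λ e → ℕP.<-irrefl (sym e) (ℕP.n<1+n k)) =
  ℤP.+-identityʳ _ ⟨ trans ⟩ (sumN-ext (suc k) reorder ⟨ trans ⟩ sym (ℤP.+-identityˡ _))
  where
  reorder : ∀ i → i < suc k →
    (if isEven i then coeffMono (1ℤ , A + i , B + (if suc i <ᵇ suc k then 1 else 0)) a b else 0ℤ)
      ≡ (if isEven i then coeffMono (1ℤ , i + A , (if suc i <ᵇ suc k then 1 else 0) + B) a b else 0ℤ)
  reorder i _ rewrite ℕP.+-comm A i | ℕP.+-comm B (if suc i <ᵇ suc k then 1 else 0) = refl

-- The letter i+1 is
--   * impossible if i > M,
--   * a new maximum if i = M: the statistics are unchanged and w ∈ 𝒜(n+1,k),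
--   * a repeated letter if i < M: allowed iff i+1 is odd and w ∈ 𝒜(n+1,k+1),
--     adding i to A and [i+1 < M] to B.
module AppendLetter (n k a b y : ℕ) (ys : List ℕ)
  (y≡1 : (y ≡ᵇ 1) ≡ true) (rg : rgAux y ys ≡ true) (len : (length ys ≡ᵇ n) ≡ true) where
  w = y ∷ ys
  M = y ⊔ maxL ys

  term : ℕ → ℤ
  term i = wordTerm (suc (suc n)) (suc k) a b (w ++ [ suc i ])

  tooLarge : ∀ i → suc M ≤ i → term i ≡ 0ℤ
  tooLarge i le rewrite len-snoc ys (suc i) | len | rgAux-snoc y ys (suc i) | y≡1 | rg
    | ≤ᵇ-false {suc i} {suc M} (s≤s le) = refl

  newMaximum : term M ≡ (if (M ≡ᵇ k) ∧ evenOnce w then coeffMono (1ℤ , Aw w + 0 , Bw w + 0) a b else 0ℤ)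
  newMaximum rewrite len-snoc ys (suc M) | len | rgAux-snoc y ys (suc M) | y≡1 | rg | ≤ᵇ-true {suc M} {suc M} ℕP.≤-refl
    | maxL-snoc ys (suc M) | sym (ℕP.⊔-assoc y (maxL ys) (suc M)) | ℕP.m≤n⇒m⊔n≡n (ℕP.n≤1+n M)
    | evenOnce-newMax w | statA-snoc y ys (suc M) | statB-snoc y ys (suc M)
    | ≤ᵇ-false {suc M} {M} ℕP.≤-refl | <ᵇ-false {suc M} {M} (ℕP.n≤1+n M) = refl

  oldLetter : ∀ i → i < M →
    term i ≡ (if (M ≡ᵇ suc k) ∧ (evenOnce w ∧ isEven i)
              then coeffMono (1ℤ , Aw w + i , Bw w + (if suc i <ᵇ M then 1 else 0)) a b else 0ℤ)
  oldLetter i i< rewrite len-snoc ys (suc i) | len | rgAux-snoc y ys (suc i) | y≡1 | rg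
    | ≤ᵇ-true {suc i} {suc M} (ℕP.m<n⇒m<1+n i<)
    | maxL-snoc ys (suc i) | sym (ℕP.⊔-assoc y (maxL ys) (suc i)) | ℕP.m≥n⇒m⊔n≡m i<
    | evenOnce-oldLetter w (suc i) (cong₂ _∧_ y≡1 rg) (s≤s z≤n) i< | isEven-suc i | not-involutive (isEven i)
    | statA-snoc y ys (suc i) | statB-snoc y ys (suc i) | ≤ᵇ-true {suc i} {M} i< = refl

  M≤ : M ≤ suc n
  M≤ with ≡ᵇ-sound y 1 y≡1 | ≡ᵇ-sound (length ys) n len
  ... | refl | refl = ℕP.⊔-lub (s≤s z≤n) (rg-max 1 ys rg)

  lastLetterSum-valid : sumN term (suc (suc n))
    ≡ wordTerm (suc n) k a b w +ℤ (if inA (suc n) (suc k) w then coeffTimes (qtInt (suc k)) (Aw w) (Bw w) a b else 0ℤ)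
  lastLetterSum-valid
    rewrite sumN-truncate {term} (suc M) (suc (suc n)) tooLarge (s≤s M≤) | newMaximum | sumN-ext {term} M oldLetter
          | len | y≡1 | rg | coeffTimes-qtInt (suc k) (Aw w) (Bw w) a b =
    assembleLastLetter a b M k (Aw w) (Bw w) (evenOnce w)

rgOfLength : ℕ → List ℕ → Bool
rgOfLength n w = (length w ≡ᵇ n) ∧ isRG w

inA-invalid : ∀ n k w → rgOfLength n w ≡ false → inA n k w ≡ false
inA-invalid n k w invalid = sym (∧-assoc (length w ≡ᵇ n) (isRG w) _) ⟨ trans ⟩ cong (_∧ _) invalid

wordTerm-invalid : ∀ n k a b w → rgOfLength n w ≡ false → wordTerm n k a b w ≡ 0ℤ
wordTerm-invalid n k a b w invalid =
  cong (λ c → if c then coeffMono (1ℤ , Aw w , Bw w) a b else 0ℤ) (inA-invalid n k w invalid)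

rgOfLength-snoc : ∀ n y ys x →
  rgOfLength (suc (suc n)) (y ∷ ys ++ [ x ]) ≡ rgOfLength (suc n) (y ∷ ys) ∧ (x ≤ᵇ suc (y ⊔ maxL ys))
rgOfLength-snoc n y ys x rewrite len-snoc ys x | rgAux-snoc y ys x =
  sym (∧-assoc (length ys ≡ᵇ n) _ _ ⟨ trans ⟩ cong ((length ys ≡ᵇ n) ∧_) (∧-assoc (y ≡ᵇ 1) (rgAux y ys) _))

lastLetterSum : ∀ n k a b w →
  sumN (λ i → wordTerm (suc (suc n)) (suc k) a b (w ++ [ suc i ])) (suc (suc n))
    ≡ wordTerm (suc n) k a b w +ℤ (if inA (suc n) (suc k) w then coeffTimes (qtInt (suc k)) (Aw w) (Bw w) a b else 0ℤ)
lastLetterSum n k a b [] = sumN-zero (suc (suc n)) (λ _ _ → refl)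
lastLetterSum n k a b (y ∷ ys) with rgOfLength (suc n) (y ∷ ys) in valid
... | true with ∧-true {length ys ≡ᵇ n} valid
... | len , rgWord with ∧-true {y ≡ᵇ 1} rgWord
... | y≡1 , rg = AppendLetter.lastLetterSum-valid n k a b y ys y≡1 rg len
lastLetterSum n k a b (y ∷ ys) | false =
  sumN-zero (suc (suc n)) (λ i _ → wordTerm-invalid (suc (suc n)) (suc k) a b (y ∷ ys ++ [ suc i ])
                                      (rgOfLength-snoc n y ys (suc i) ⟨ trans ⟩ cong (_∧ _) valid))
  ⟨ trans ⟩ sym (cong₂ _+ℤ_ (wordTerm-invalid (suc n) k a b (y ∷ ys) valid)
                            (cong (λ c → if c then coeffTimes (qtInt (suc k)) _ _ a b else 0ℤ)
                                  (inA-invalid (suc n) (suc k) (y ∷ ys) valid)))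

Sqt-recurrence : ∀ n k a b →
  coeff (Sqt (suc (suc n)) (suc k)) a b ≡ coeff (Sqt (suc n) k +P qtInt (suc k) *P Sqt (suc n) (suc k)) a b
Sqt-recurrence n k a b = begin
  coeff (Sqt (suc (suc n)) (suc k)) a b
    ≡⟨ Sqt-coeff (suc n) (suc k) a b ⟩
  sumWords (suc (suc n)) (suc (suc n)) (wordTerm (suc (suc n)) (suc k) a b)
    ≡⟨ sumWords-snoc (suc n) (suc (suc n)) _ ⟩
  sumWords (suc n) (suc (suc n)) _
    ≡⟨ sumWords-ext (suc n) (suc (suc n)) (lastLetterSum n k a b) ⟩
  sumWords (suc n) (suc (suc n)) split
    ≡⟨ sumWords-shrink (suc n) (suc n) split tooLarge ⟩
  sumWords (suc n) (suc n) split
    ≡⟨ sumL-+ (wordTerm (suc n) k a b) times (allWords (suc n) (suc n)) ⟩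
  sumWords (suc n) (suc n) (wordTerm (suc n) k a b) +ℤ sumWords (suc n) (suc n) times
    ≡⟨ cong₂ _+ℤ_ (sym (Sqt-coeff n k a b)) (sym product) ⟩
  coeff (Sqt (suc n) k) a b +ℤ coeff (qtInt (suc k) *P Sqt (suc n) (suc k)) a b
    ≡⟨ sym (coeff-+P (Sqt (suc n) k) _ a b) ⟩
  coeff (Sqt (suc n) k +P qtInt (suc k) *P Sqt (suc n) (suc k)) a b ∎
  where
  open ≡-Reasoning
  times : List ℕ → ℤ
  times w = if inA (suc n) (suc k) w then coeffTimes (qtInt (suc k)) (Aw w) (Bw w) a b else 0ℤ
  split : List ℕ → ℤ
  split w = wordTerm (suc n) k a b w +ℤ times w
  tooLarge : ∀ w → suc n < maxL w → split w ≡ 0ℤ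
  tooLarge w lt with inA (suc n) k w in ea | inA (suc n) (suc k) w in eb
  ... | true | _ = ⊥-elim (ℕP.<⇒≱ lt (inA-max _ _ w ea))
  ... | false | true = ⊥-elim (ℕP.<⇒≱ lt (inA-max _ _ w eb))
  ... | false | false = refl
  product : coeff (qtInt (suc k) *P Sqt (suc n) (suc k)) a b ≡ sumWords (suc n) (suc n) times
  product = coeff-times-scaled-filter (qtInt (suc k)) (inA (suc n) (suc k)) (allWords (suc n) (suc n)) 1ℤ Aw Bw a b
            ⟨ trans ⟩ ℤP.*-identityˡ _

-- Rook placements.  The statistics of a placement do not depend on the
-- order in which its rooks are listed.

∧-swap3 : ∀ a b c → a ∧ (b ∧ c) ≡ b ∧ (a ∧ c)
∧-swap3 true b c = refl
∧-swap3 false b c = sym (∧-zeroʳ b)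

allᵇ-↭ : ∀ {A : Set} (p : A → Bool) {xs ys : List A} → xs ↭ ys → allᵇ p xs ≡ allᵇ p ys
allᵇ-↭ p ↭-refl = refl
allᵇ-↭ p (prep x q) = cong (p x ∧_) (allᵇ-↭ p q)
allᵇ-↭ p (swap x y q) = cong (λ z → p x ∧ (p y ∧ z)) (allᵇ-↭ p q) ⟨ trans ⟩ ∧-swap3 (p x) (p y) _
allᵇ-↭ p (↭-step q r) = trans (allᵇ-↭ p q) (allᵇ-↭ p r)

columnFree : ℕ → List Square → Bool
columnFree j T = allᵇ (λ s → not (j ≡ᵇ proj₂ s)) T

columnsDistinct-↭ : ∀ {xs ys : List Square} → xs ↭ ys → columnsDistinct xs ≡ columnsDistinct ys
columnsDistinct-↭ ↭-refl = refl
columnsDistinct-↭ (prep (i , j) q) = cong₂ _∧_ (allᵇ-↭ (λ s → not (j ≡ᵇ proj₂ s)) q) (columnsDistinct-↭ q)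
columnsDistinct-↭ {(i , j) ∷ (k , l) ∷ xs} {_ ∷ _ ∷ ys} (swap (i , j) (k , l) q) =
  cong₂ (λ u v → (not (j ≡ᵇ l) ∧ u) ∧ (v ∧ columnsDistinct xs))
        (allᵇ-↭ (λ s → not (j ≡ᵇ proj₂ s)) q) (allᵇ-↭ (λ s → not (l ≡ᵇ proj₂ s)) q)
  ⟨ trans ⟩ cong (λ z → (not (j ≡ᵇ l) ∧ columnFree j ys) ∧ (columnFree l ys ∧ z)) (columnsDistinct-↭ q)
  ⟨ trans ⟩ exchange (j ≡ᵇ l) (columnFree j ys) (columnFree l ys) (columnsDistinct ys)
  ⟨ trans ⟩ cong (λ z → (not z ∧ columnFree l ys) ∧ (columnFree j ys ∧ columnsDistinct ys)) (≡ᵇ-sym j l)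
  where
  exchange : ∀ e a b c → (not e ∧ a) ∧ (b ∧ c) ≡ (not e ∧ b) ∧ (a ∧ c)
  exchange true a b c = refl
  exchange false a b c = ∧-swap3 a b c
columnsDistinct-↭ (↭-step q r) = trans (columnsDistinct-↭ q) (columnsDistinct-↭ r)

squaresBelow : ℕ → Square → ℕ
squaresBelow N (i , j) = N ∸ (i + j)

notRowOne : Square → ℕ
notRowOne (i , j) = if i ≡ᵇ 1 then 0 else 1

below-sum : ∀ N T → below N T ≡ sum (map (squaresBelow N) T)
below-sum N [] = refl
below-sum N ((i , j) ∷ T) = cong (N ∸ (i + j) +_) (below-sum N T)

nrow-sum : ∀ T → nrow T ≡ sum (map notRowOne T)
nrow-sum [] = refl
nrow-sum ((i , j) ∷ T) = cong ((if i ≡ᵇ 1 then 0 else 1) +_) (nrow-sum T)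

below-↭ : ∀ N {xs ys : List Square} → xs ↭ ys → below N xs ≡ below N ys
below-↭ N {xs} {ys} p = below-sum N xs ⟨ trans ⟩ (sum-↭ (map⁺ (squaresBelow N) p) ⟨ trans ⟩ sym (below-sum N ys))

nrow-↭ : ∀ {xs ys : List Square} → xs ↭ ys → nrow xs ≡ nrow ys
nrow-↭ {xs} {ys} p = nrow-sum xs ⟨ trans ⟩ (sum-↭ (map⁺ notRowOne p) ⟨ trans ⟩ sym (nrow-sum ys))

module _ {A : Set} where
  PermInvariant : (List A → ℤ) → Set
  PermInvariant F = ∀ {T T'} → T ↭ T' → F T ≡ F T'

  sublists-cons : (F : List A → ℤ) (x : A) (xs : List A) →
    sumL F (sublists (x ∷ xs)) ≡ sumL F (sublists xs) +ℤ sumL (λ T → F (x ∷ T)) (sublists xs)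
  sublists-cons F x xs =
    sumL-++ F (sublists xs) _ ⟨ trans ⟩ cong (sumL F (sublists xs) +ℤ_) (sumL-map F (x ∷_) (sublists xs))

  sublists-↭ : {xs ys : List A} → xs ↭ ys → (F : List A → ℤ) → PermInvariant F →
               sumL F (sublists xs) ≡ sumL F (sublists ys)
  sublists-↭ ↭-refl F inv = refl
  sublists-↭ {_ ∷ xs} {_ ∷ ys} (prep x q) F inv =
    sublists-cons F x xs ⟨ trans ⟩
    (cong₂ _+ℤ_ (sublists-↭ q F inv) (sublists-↭ q (λ T → F (x ∷ T)) (λ r → inv (prep x r)))
     ⟨ trans ⟩ sym (sublists-cons F x ys))
  sublists-↭ {_ ∷ _ ∷ xs} {_ ∷ _ ∷ ys} (swap x y q) F inv = begin
    sumL F (sublists (x ∷ y ∷ xs))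
      ≡⟨ sublists-cons F x (y ∷ xs) ⟨ trans ⟩ cong₂ _+ℤ_ (sublists-cons F y xs) (sublists-cons (λ T → F (x ∷ T)) y xs) ⟩
    (sumSub F xs +ℤ sumSub (λ T → F (y ∷ T)) xs) +ℤ (sumSub (λ T → F (x ∷ T)) xs +ℤ sumSub (λ T → F (x ∷ y ∷ T)) xs)
      ≡⟨ cong₂ _+ℤ_ (cong₂ _+ℤ_ (sublists-↭ q F inv) (sublists-↭ q (λ T → F (y ∷ T)) (λ r → inv (prep y r))))
                    (cong₂ _+ℤ_ (sublists-↭ q (λ T → F (x ∷ T)) (λ r → inv (prep x r)))
                                (sublists-↭ q (λ T → F (x ∷ y ∷ T)) (λ r → inv (prep x (prep y r))))) ⟩
    (sumSub F ys +ℤ sumSub (λ T → F (y ∷ T)) ys) +ℤ (sumSub (λ T → F (x ∷ T)) ys +ℤ sumSub (λ T → F (x ∷ y ∷ T)) ys)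
      ≡⟨ cong (λ z → (sumSub F ys +ℤ sumSub (λ T → F (y ∷ T)) ys) +ℤ (sumSub (λ T → F (x ∷ T)) ys +ℤ z))
              (sumL-ext (λ T → inv (swap x y ↭-refl)) (sublists ys)) ⟩
    (sumSub F ys +ℤ sumSub (λ T → F (y ∷ T)) ys) +ℤ (sumSub (λ T → F (x ∷ T)) ys +ℤ sumSub (λ T → F (y ∷ x ∷ T)) ys)
      ≡⟨ +-interchange (sumSub F ys) (sumSub (λ T → F (y ∷ T)) ys) (sumSub (λ T → F (x ∷ T)) ys) _ ⟩
    (sumSub F ys +ℤ sumSub (λ T → F (x ∷ T)) ys) +ℤ (sumSub (λ T → F (y ∷ T)) ys +ℤ sumSub (λ T → F (y ∷ x ∷ T)) ys)
      ≡⟨ sym (sublists-cons F y (x ∷ ys) ⟨ trans ⟩ cong₂ _+ℤ_ (sublists-cons F x ys) (sublists-cons (λ T → F (y ∷ T)) x ys)) ⟩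
    sumL F (sublists (y ∷ x ∷ ys)) ∎
    where
    open ≡-Reasoning
    sumSub : (List A → ℤ) → List A → ℤ
    sumSub G zs = sumL G (sublists zs)
  sublists-↭ (↭-step q r) F inv = trans (sublists-↭ q F inv) (sublists-↭ r F inv)

module _ {A : Set} where
  sublists-++ : (F : List A → ℤ) (xs ys : List A) →
    sumL F (sublists (xs ++ ys)) ≡ sumL (λ U → sumL (λ V → F (U ++ V)) (sublists ys)) (sublists xs)
  sublists-++ F [] ys = sym (ℤP.+-identityʳ _)
  sublists-++ F (x ∷ xs) ys =
    sublists-cons F x (xs ++ ys) ⟨ trans ⟩
    (cong₂ _+ℤ_ (sublists-++ F xs ys) (sublists-++ (λ T → F (x ∷ T)) xs ys) ⟨ trans ⟩ sym (sublists-cons _ x xs))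

  sublists-ext-All : (P : A → Set) {F F' : List A → ℤ} (xs : List A) → All P xs →
    (∀ T → All P T → F T ≡ F' T) → sumL F (sublists xs) ≡ sumL F' (sublists xs)
  sublists-ext-All P [] _ e = cong (_+ℤ 0ℤ) (e [] [])
  sublists-ext-All P (x ∷ xs) (px ∷ pxs) e =
    sublists-cons _ x xs ⟨ trans ⟩
    (cong₂ _+ℤ_ (sublists-ext-All P xs pxs e) (sublists-ext-All P xs pxs (λ T pT → e (x ∷ T) (px ∷ pT)))
     ⟨ trans ⟩ sym (sublists-cons _ x xs))

module _ {A B : Set} where
  sublists-map : (F : List B → ℤ) (f : A → B) (xs : List A) →
    sumL F (sublists (map f xs)) ≡ sumL (λ T → F (map f T)) (sublists xs)
  sublists-map F f [] = refl
  sublists-map F f (x ∷ xs) =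
    sublists-cons F (f x) (map f xs) ⟨ trans ⟩
    (cong₂ _+ℤ_ (sublists-map F f xs) (sublists-map (λ T → F (f x ∷ T)) f xs) ⟨ trans ⟩ sym (sublists-cons _ x xs))

InColumnOne : Square → Set
InColumnOne s = proj₂ s ≡ 1

rearrange : ∀ a b c → (a +ℤ b) +ℤ (c +ℤ 0ℤ) ≡ a +ℤ (c +ℤ b)
rearrange = solve-∀

sublists-atMostOne : (xs : List Square) → All InColumnOne xs → (Φ : List Square → ℤ) →
  (∀ x y U → InColumnOne x → InColumnOne y → Φ (x ∷ y ∷ U) ≡ 0ℤ) →
  sumL Φ (sublists xs) ≡ Φ [] +ℤ sumL (λ c → Φ (c ∷ [])) xs
sublists-atMostOne [] _ Φ h = refl
sublists-atMostOne (x ∷ xs) (px ∷ pxs) Φ h = begin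
  sumL Φ (sublists (x ∷ xs))
    ≡⟨ sublists-cons Φ x xs ⟩
  sumL Φ (sublists xs) +ℤ sumL (λ T → Φ (x ∷ T)) (sublists xs)
    ≡⟨ cong₂ _+ℤ_ (sublists-atMostOne xs pxs Φ h)
                  (sublists-atMostOne xs pxs (λ T → Φ (x ∷ T)) (λ y z U py pz → h x y (z ∷ U) px py)) ⟩
  (Φ [] +ℤ sumL (λ c → Φ (c ∷ [])) xs) +ℤ (Φ (x ∷ []) +ℤ sumL (λ c → Φ (x ∷ c ∷ [])) xs)
    ≡⟨ cong (λ z → (Φ [] +ℤ sumL (λ c → Φ (c ∷ [])) xs) +ℤ (Φ (x ∷ []) +ℤ z))
            (sumL-ext-All InColumnOne xs pxs (λ y py → h x y [] px py) ⟨ trans ⟩ sumL-zero (λ _ → refl) xs) ⟩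
  (Φ [] +ℤ sumL (λ c → Φ (c ∷ [])) xs) +ℤ (Φ (x ∷ []) +ℤ 0ℤ)
    ≡⟨ rearrange (Φ []) _ (Φ (x ∷ [])) ⟩
  Φ [] +ℤ (Φ (x ∷ []) +ℤ sumL (λ c → Φ (c ∷ [])) xs) ∎
  where open ≡-Reasoning

-- The staircase board of length N+1 is its first column together with a
-- copy of the board of length N shifted one column to the right.

shift : Square → Square
shift (i , j) = (i , suc j)

isShaded : ℕ → Square → Bool
isShaded N (i , j) = ((i + j) ≤ᵇ N) ∧ isEven (N ∸ (i + j))

rows : ℕ → List ℕ
rows N = map suc (upTo N)

row : ℕ → ℕ → List Square
row N i = map (λ j → (i , j)) (map suc (upTo N))

grid : ℕ → List Square
grid N = concatMap (row N) (rows N)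

firstColumn : ℕ → List Square
firstColumn N = filterᵇ (isShaded (suc N)) (map (λ i → (i , 1)) (rows (suc N)))

filterᵇ-cons : {A : Set} (p : A → Bool) (x : A) (xs : List A) →
  filterᵇ p (x ∷ xs) ≡ (if p x then x ∷ filterᵇ p xs else filterᵇ p xs)
filterᵇ-cons p x xs with p x
... | true = refl
... | false = refl

filterᵇ-ext : {A : Set} {p q : A → Bool} → (∀ x → p x ≡ q x) → ∀ xs → filterᵇ p xs ≡ filterᵇ q xs
filterᵇ-ext {p = p} {q} e [] = refl
filterᵇ-ext {p = p} {q} e (x ∷ xs) rewrite filterᵇ-cons p x xs | filterᵇ-cons q x xs | e x | filterᵇ-ext e xs = refl

filterᵇ-none : {A : Set} {p : A → Bool} → (∀ x → p x ≡ false) → ∀ xs → filterᵇ p xs ≡ []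
filterᵇ-none {p = p} e [] = refl
filterᵇ-none {p = p} e (x ∷ xs) rewrite filterᵇ-cons p x xs | e x = filterᵇ-none e xs

filterᵇ-map : {A B : Set} (p : B → Bool) (f : A → B) (xs : List A) → filterᵇ p (map f xs) ≡ map f (filterᵇ (p ∘ f) xs)
filterᵇ-map p f [] = refl
filterᵇ-map p f (x ∷ xs) rewrite filterᵇ-cons p (f x) (map f xs) | filterᵇ-cons (p ∘ f) x xs | filterᵇ-map p f xs with p (f x)
... | true = refl
... | false = refl

concatMap-heads : {A B : Set} (f : A → B) (g : A → List B) (is : List A) →
  concatMap (λ i → f i ∷ g i) is ↭ map f is ++ concatMap g is
concatMap-heads f g [] = ↭-refl
concatMap-heads f g (i ∷ is) = prep (f i) (↭-trans (++⁺ˡ (g i) (concatMap-heads f g is)) (shifts (g i) (map f is)))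

≤ᵇ-suc : ∀ m n → (suc m ≤ᵇ suc n) ≡ (m ≤ᵇ n)
≤ᵇ-suc zero n = refl
≤ᵇ-suc (suc m) n = refl

isShaded-shift : ∀ N s → isShaded (suc N) (shift s) ≡ isShaded N s
isShaded-shift N (i , j) rewrite ℕP.+-suc i j | ≤ᵇ-suc (i + j) N = refl

rows-suc : ∀ N → rows (suc N) ≡ 1 ∷ map suc (rows N)
rows-suc N = cong (1 ∷_) (cong (map suc) (sym (map-applyUpTo (λ x → x) suc N)))

rows-snoc : ∀ N → rows (suc N) ≡ rows N ++ [ suc N ]
rows-snoc N = cong (map suc) (sym (upTo-∷ʳ N)) ⟨ trans ⟩ map-++ suc (upTo N) [ N ]

map-pair-suc : ∀ i (X : List ℕ) → map (λ j → (i , j)) (map suc X) ≡ map shift (map (λ j → (i , j)) X)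
map-pair-suc i [] = refl
map-pair-suc i (x ∷ X) = cong ((i , suc x) ∷_) (map-pair-suc i X)

row-suc : ∀ N i → row (suc N) i ≡ (i , 1) ∷ map shift (row N i)
row-suc N i = cong (map (λ j → (i , j))) (rows-suc N) ⟨ trans ⟩ cong ((i , 1) ∷_) (map-pair-suc i (map suc (upTo N)))

lastRow-unshaded : ∀ N → filterᵇ (isShaded N) (row N (suc N)) ≡ []
lastRow-unshaded N =
  filterᵇ-map (isShaded N) (λ j → (suc N , j)) (map suc (upTo N)) ⟨ trans ⟩
  cong (map (λ j → (suc N , j)))
    (filterᵇ-map (isShaded N ∘ (λ j → (suc N , j))) suc (upTo N) ⟨ trans ⟩
     cong (map suc) (filterᵇ-none (λ x → cong (_∧ isEven (N ∸ (suc N + suc x)))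
                                              (≤ᵇ-false (ℕP.≤-trans (ℕP.n<1+n N) (ℕP.m≤m+n (suc N) (suc x))))) (upTo N)))

shaded-decompose : ∀ N → shaded (suc N) ↭ firstColumn N ++ map shift (shaded N)
shaded-decompose N = ↭-trans (filter-↭ (T? ∘ isShaded (suc N)) gridPerm) (↭-reflexive filtered)
  where
  C = map (λ i → (i , 1)) (rows (suc N))
  shiftedRows : concatMap (λ i → map shift (row N i)) (rows (suc N))
                ≡ map shift (grid N) ++ (map shift (row N (suc N)) ++ [])
  shiftedRows =
    cong (concatMap (λ i → map shift (row N i))) (rows-snoc N) ⟨ trans ⟩
    (concatMap-++ (λ i → map shift (row N i)) (rows N) [ suc N ] ⟨ trans ⟩
     cong (_++ (map shift (row N (suc N)) ++ [])) (sym (map-concatMap shift (row N) (rows N))))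
  gridPerm : grid (suc N) ↭ C ++ (map shift (grid N) ++ (map shift (row N (suc N)) ++ []))
  gridPerm =
    ↭-trans (↭-reflexive (concatMap-cong (row-suc N) (rows (suc N))))
            (↭-trans (concatMap-heads (λ i → (i , 1)) (λ i → map shift (row N i)) (rows (suc N)))
                     (↭-reflexive (cong (C ++_) shiftedRows)))
  filter-shift : ∀ X → filterᵇ (isShaded (suc N)) (map shift X) ≡ map shift (filterᵇ (isShaded N) X)
  filter-shift X = filterᵇ-map (isShaded (suc N)) shift X ⟨ trans ⟩ cong (map shift) (filterᵇ-ext (isShaded-shift N) X)
  filtered : filterᵇ (isShaded (suc N)) (C ++ (map shift (grid N) ++ (map shift (row N (suc N)) ++ [])))
             ≡ firstColumn N ++ map shift (shaded N)
  filtered =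
    filter-++ (T? ∘ isShaded (suc N)) C _ ⟨ trans ⟩
    cong (firstColumn N ++_)
      (filter-++ (T? ∘ isShaded (suc N)) (map shift (grid N)) _ ⟨ trans ⟩
       (cong₂ _++_ (filter-shift (grid N))
                   (filter-++ (T? ∘ isShaded (suc N)) (map shift (row N (suc N))) [] ⟨ trans ⟩
                    cong (_++ []) (filter-shift (row N (suc N)) ⟨ trans ⟩ cong (map shift) (lastRow-unshaded N)))
        ⟨ trans ⟩ ++-identityʳ _))

PositiveColumn : Square → Set
PositiveColumn s = 1 ≤ proj₂ s

shaded-positive : ∀ N → All PositiveColumn (shaded N)
shaded-positive N = All-filter⁺ (T? ∘ isShaded N) (rowsPositive (rows N))
  where
  rowPositive : ∀ i (U : List ℕ) → All PositiveColumn (map (λ j → (i , j)) (map suc U))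
  rowPositive i [] = []
  rowPositive i (u ∷ U) = s≤s z≤n ∷ rowPositive i U
  rowsPositive : ∀ (is : List ℕ) → All PositiveColumn (concatMap (row N) is)
  rowsPositive [] = []
  rowsPositive (i ∷ is) = All-++⁺ (rowPositive i (upTo N)) (rowsPositive is)

firstColumn-inColumnOne : ∀ N → All InColumnOne (firstColumn N)
firstColumn-inColumnOne N = All-filter⁺ (T? ∘ isShaded (suc N)) (pairsWithOne (rows (suc N)))
  where
  pairsWithOne : ∀ (is : List ℕ) → All InColumnOne (map (λ i → (i , 1)) is)
  pairsWithOne [] = []
  pairsWithOne (i ∷ is) = refl ∷ pairsWithOne is

placementTerm : ℕ → (List Square → ℤ) → List Square → ℤ
placementTerm r g T = if (length T ≡ᵇ r) ∧ columnsDistinct T then g T else 0ℤ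

sumPlacements : ℕ → ℕ → (List Square → ℤ) → ℤ
sumPlacements N r g = sumL (placementTerm r g) (sublists (shaded N))

sumPlacements-ext : ∀ N r {g g'} → (∀ T → g T ≡ g' T) → sumPlacements N r g ≡ sumPlacements N r g'
sumPlacements-ext N r e =
  sumL-ext (λ T → cong (λ z → if (length T ≡ᵇ r) ∧ columnsDistinct T then z else 0ℤ) (e T)) (sublists (shaded N))

placementTerm-invariant : ∀ r g → PermInvariant g → PermInvariant (placementTerm r g)
placementTerm-invariant r g inv {T} {T'} p rewrite ↭-length p | columnsDistinct-↭ p | inv p = refl

columnFree-shift : ∀ j T → columnFree (suc j) (map shift T) ≡ columnFree j T
columnFree-shift j [] = refl
columnFree-shift j ((k , l) ∷ T) = cong (not (j ≡ᵇ l) ∧_) (columnFree-shift j T)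

columnsDistinct-shift : ∀ T → columnsDistinct (map shift T) ≡ columnsDistinct T
columnsDistinct-shift [] = refl
columnsDistinct-shift ((k , l) ∷ T) = cong₂ _∧_ (columnFree-shift l T) (columnsDistinct-shift T)

columnOne-free : ∀ T → All PositiveColumn T → columnFree 1 (map shift T) ≡ true
columnOne-free [] [] = refl
columnOne-free ((k , suc l) ∷ T) (_ ∷ p) = columnOne-free T p

placementTerm-shift : ∀ r g T → placementTerm r g (map shift T) ≡ placementTerm r (g ∘ map shift) T
placementTerm-shift r g T rewrite length-map shift T | columnsDistinct-shift T = refl

withRookTerm : ℕ → (List Square → ℤ) → Square → List Square → ℤ
withRookTerm zero g c T = 0ℤ
withRookTerm (suc r) g c T = placementTerm r (λ T → g (c ∷ map shift T)) T

placementTerm-withRook : ∀ r g c T → InColumnOne c → All PositiveColumn T →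
  placementTerm r g (c ∷ map shift T) ≡ withRookTerm r g c T
placementTerm-withRook r g (i , .1) T refl p =
  cong (λ z → if (suc (length (map shift T)) ≡ᵇ r) ∧ (z ∧ columnsDistinct (map shift T)) then g ((i , 1) ∷ map shift T) else 0ℤ)
       (columnOne-free T p)
  ⟨ trans ⟩ byCount r
  where
  byCount : ∀ r → (if (suc (length (map shift T)) ≡ᵇ r) ∧ (true ∧ columnsDistinct (map shift T))
                   then g ((i , 1) ∷ map shift T) else 0ℤ) ≡ withRookTerm r g (i , 1) T
  byCount zero = refl
  byCount (suc r') rewrite length-map shift T | columnsDistinct-shift T = refl

-- Two rooks in column 1 attack each other.
placementTerm-twoInColumnOne : ∀ r g i k W → placementTerm r g ((i , 1) ∷ (k , 1) ∷ W) ≡ 0ℤ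
placementTerm-twoInColumnOne r g i k W with length ((i , 1) ∷ (k , 1) ∷ W) ≡ᵇ r
... | true = refl
... | false = refl

withFirstColumnRook : ℕ → ℕ → (List Square → ℤ) → ℤ
withFirstColumnRook N zero g = 0ℤ
withFirstColumnRook N (suc r) g = sumPlacements N r (λ T → sumL (λ c → g (c ∷ map shift T)) (firstColumn N))

sumPlacements-suc : ∀ N r g → PermInvariant g →
  sumPlacements (suc N) r g ≡ sumPlacements N r (g ∘ map shift) +ℤ withFirstColumnRook N r g
sumPlacements-suc N r g inv = begin
  sumPlacements (suc N) r g
    ≡⟨ sublists-↭ (shaded-decompose N) (placementTerm r g) (placementTerm-invariant r g inv) ⟩
  sumL (placementTerm r g) (sublists (firstColumn N ++ map shift S))
    ≡⟨ sublists-++ (placementTerm r g) (firstColumn N) (map shift S) ⟩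
  sumL Φ (sublists (firstColumn N))
    ≡⟨ sublists-atMostOne (firstColumn N) (firstColumn-inColumnOne N) Φ twoInColumnOne ⟩
  Φ [] +ℤ sumL (λ c → Φ (c ∷ [])) (firstColumn N)
    ≡⟨ cong₂ _+ℤ_ noRook (oneRook ⟨ trans ⟩ regroup r) ⟩
  sumPlacements N r (g ∘ map shift) +ℤ withFirstColumnRook N r g ∎
  where
  open ≡-Reasoning
  S = shaded N
  Φ : List Square → ℤ
  Φ U = sumL (λ V → placementTerm r g (U ++ V)) (sublists (map shift S))
  twoInColumnOne : ∀ x y U → InColumnOne x → InColumnOne y → Φ (x ∷ y ∷ U) ≡ 0ℤ
  twoInColumnOne (i , .1) (k , .1) U refl refl =
    sumL-zero (λ V → placementTerm-twoInColumnOne r g i k (U ++ V)) (sublists (map shift S))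
  noRook : Φ [] ≡ sumPlacements N r (g ∘ map shift)
  noRook = sublists-map (placementTerm r g) shift S ⟨ trans ⟩ sumL-ext (placementTerm-shift r g) (sublists S)
  oneRook : sumL (λ c → Φ (c ∷ [])) (firstColumn N) ≡ sumL (λ c → sumL (withRookTerm r g c) (sublists S)) (firstColumn N)
  oneRook = sumL-ext-All InColumnOne (firstColumn N) (firstColumn-inColumnOne N)
              (λ c pc → sublists-map (λ V → placementTerm r g (c ∷ V)) shift S ⟨ trans ⟩
                        sublists-ext-All PositiveColumn S (shaded-positive N) (λ T pT → placementTerm-withRook r g c T pc pT))
  regroup : ∀ r → sumL (λ c → sumL (withRookTerm r g c) (sublists S)) (firstColumn N) ≡ withFirstColumnRook N r g
  regroup zero = sumL-zero (λ c → sumL-zero (λ _ → refl) (sublists S)) (firstColumn N)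
  regroup (suc r') =
    sumL-swap (λ c T → placementTerm r' (λ T → g (c ∷ map shift T)) T) (firstColumn N) (sublists S) ⟨ trans ⟩
    sumL-ext (λ T → sumL-if ((length T ≡ᵇ r') ∧ columnsDistinct T) (λ c → g (c ∷ map shift T)) (firstColumn N)) (sublists S)

rookWeight : ℕ → ℕ → ℕ → List Square → ℤ
rookWeight N a b T = coeffMono (1ℤ , below N T , nrow T) a b

rookWeight-invariant : ∀ N a b → PermInvariant (rookWeight N a b)
rookWeight-invariant N a b p rewrite below-↭ N p | nrow-↭ p = refl

below-shift : ∀ N T → below (suc N) (map shift T) ≡ below N T
below-shift N [] = refl
below-shift N ((i , j) ∷ T) rewrite ℕP.+-suc i j = cong (N ∸ (i + j) +_) (below-shift N T)

nrow-shift : ∀ T → nrow (map shift T) ≡ nrow T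
nrow-shift [] = refl
nrow-shift ((i , j) ∷ T) = cong ((if i ≡ᵇ 1 then 0 else 1) +_) (nrow-shift T)

rookWeight-shift : ∀ N a b T → rookWeight (suc N) a b (map shift T) ≡ rookWeight N a b T
rookWeight-shift N a b T rewrite below-shift N T | nrow-shift T = refl

sqt-coeff : ∀ N k a b → k ≤ suc N →
  coeff (sqt (suc N) k) a b ≡ sign (suc N ∸ k) *ℤ sumPlacements (suc N) (suc N ∸ k) (rookWeight (suc N) a b)
sqt-coeff N k a b k≤ rewrite ≤ᵇ-true k≤ =
  coeff-scaled-filter _ (sublists (shaded (suc N))) (sign (suc N ∸ k)) (below (suc N)) nrow a b

columnRookWeight : ℕ → ℕ → ℕ → ℕ → ℕ → Square → ℤ
columnRookWeight N B R a b c = coeffMono (1ℤ , squaresBelow (suc N) c + B , notRowOne c + R) a b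

-- The shaded square (e+1, 1) of the board of length N+1 = d+e+2 has d squares
-- below it and lies in row 1 exactly when d+1 = N.
firstColumn-reindex : ∀ B R a b d e N → suc (d + e) ≡ N →
  (if isShaded (suc N) (suc e , 1) then columnRookWeight N B R a b (suc e , 1) else 0ℤ)
    ≡ (if isEven d then coeffMono (1ℤ , d + B , (if suc d <ᵇ N then 1 else 0) + R) a b else 0ℤ)
firstColumn-reindex B R a b d e .(suc (d + e)) refl
  rewrite ℕP.+-comm e 1 | ℕP.m+n∸n≡m d e | ≤ᵇ-true {suc (suc e)} {suc (suc (d + e))} (s≤s (s≤s (ℕP.m≤n+m e d))) with e
... | zero rewrite ℕP.+-identityʳ d | <ᵇ-false {d} {d} ℕP.≤-refl = refl
... | suc e' rewrite <ᵇ-true {d} {d + suc e'} (ℕP.m<m+n d (s≤s z≤n)) = refl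

firstColumnSum : ∀ N B R a b → sumL (columnRookWeight N B R a b) (firstColumn N) ≡ qtIntSum N B R a b
firstColumnSum N B R a b = begin
  sumL h (firstColumn N)
    ≡⟨ sumL-filter (isShaded (suc N)) h (map (λ i → (i , 1)) (rows (suc N))) ⟩
  sumL (λ c → if isShaded (suc N) c then h c else 0ℤ) (map (λ i → (i , 1)) (rows (suc N)))
    ≡⟨ sumL-map (λ c → if isShaded (suc N) c then h c else 0ℤ) (λ i → (i , 1)) (rows (suc N)) ⟨ trans ⟩
       (sumL-map (λ i → if isShaded (suc N) (i , 1) then h (i , 1) else 0ℤ) suc (upTo (suc N)) ⟨ trans ⟩
        sumL-upTo rowTerm (suc N)) ⟩
  sumN rowTerm N +ℤ rowTerm N
    ≡⟨ cong (sumN rowTerm N +ℤ_) outsideBoard ⟨ trans ⟩ ℤP.+-identityʳ _ ⟩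
  sumN rowTerm N
    ≡⟨ sumN-reverse rowTerm N ⟩
  sumN (λ d → rowTerm (N ∸ suc d)) N
    ≡⟨ sumN-ext N (λ d d< → firstColumn-reindex B R a b d (N ∸ suc d) N (ℕP.m+[n∸m]≡n d<)) ⟩
  qtIntSum N B R a b ∎
  where
  open ≡-Reasoning
  h = columnRookWeight N B R a b
  rowTerm : ℕ → ℤ
  rowTerm i = if isShaded (suc N) (suc i , 1) then h (suc i , 1) else 0ℤ
  outsideBoard : rowTerm N ≡ 0ℤ
  outsideBoard rewrite ≤ᵇ-false {suc N + 1} {suc N} (ℕP.m<m+n (suc N) (s≤s z≤n)) = refl

qtTimesPlacements : ℕ → ℕ → ℕ → ℕ → ℤ
qtTimesPlacements N zero a b = 0ℤ
qtTimesPlacements N (suc r) a b = sumPlacements N r (λ T → coeffTimes (qtInt N) (below N T) (nrow T) a b)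

-- The rook recurrence: a placement on the board of length N+1 has either no
-- rook in the first column, or one rook there contributing [N]_{q,t}.
rookSum-suc : ∀ N r a b →
  sumPlacements (suc N) r (rookWeight (suc N) a b) ≡ sumPlacements N r (rookWeight N a b) +ℤ qtTimesPlacements N r a b
rookSum-suc N r a b =
  sumPlacements-suc N r (rookWeight (suc N) a b) (rookWeight-invariant (suc N) a b) ⟨ trans ⟩
  cong₂ _+ℤ_ (sumPlacements-ext N r (rookWeight-shift N a b)) (firstColumnTerm r)
  where
  firstColumnTerm : ∀ r → withFirstColumnRook N r (rookWeight (suc N) a b) ≡ qtTimesPlacements N r a b
  firstColumnTerm zero = refl
  firstColumnTerm (suc r) = sumPlacements-ext N r (λ T →
    sumL-ext (λ c → cong₂ (λ u v → coeffMono (1ℤ , squaresBelow (suc N) c + u , notRowOne c + v) a b)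
                          (below-shift N T) (nrow-shift T)) (firstColumn N)
    ⟨ trans ⟩ firstColumnSum N (below N T) (nrow T) a b ⟨ trans ⟩ sym (coeffTimes-qtInt N (below N T) (nrow T) a b))

sign-suc : ∀ r → sign (suc r) ≡ - sign r
sign-suc r rewrite isEven-suc r with isEven r
... | true = refl
... | false = refl

coeff-*P-[] : ∀ (p : Poly) a b → coeff (p *P []) a b ≡ 0ℤ
coeff-*P-[] p a b = coeff-*P p [] a b ⟨ trans ⟩ sumL-zero (λ _ → refl) p

qtTerm-sign : ∀ M k a b → k ≤ suc M →
  sign (suc M ∸ k) *ℤ qtTimesPlacements (suc M) (suc M ∸ k) a b ≡ - coeff (qtInt (suc M) *P sqt (suc M) (suc k)) a b
qtTerm-sign M k a b k≤N with ℕP.m≤n⇒m<n∨m≡n k≤N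
... | inj₂ refl rewrite ℕP.n∸n≡0 M | ≤ᵇ-false {suc (suc M)} {suc M} ℕP.≤-refl =
  ℤP.*-zeroʳ 1ℤ ⟨ trans ⟩ sym (cong -_ (coeff-*P-[] (qtInt (suc M)) a b))
... | inj₁ k<N rewrite ℕP.+-∸-assoc 1 (s≤s⁻¹ k<N) | ≤ᵇ-true k<N | sign-suc (M ∸ k) =
  sym (cong -_ (coeff-times-scaled-filter (qtInt (suc M)) _ (sublists (shaded (suc M))) (sign (M ∸ k)) (below (suc M)) nrow a b)
       ⟨ trans ⟩ ℤP.neg-distribˡ-* (sign (M ∸ k)) _)

sqt-recurrence : ∀ M k a b → k ≤ suc M →
  coeff (sqt (suc (suc M)) (suc k)) a b ≡ coeff (sqt (suc M) k -P qtInt (suc M) *P sqt (suc M) (suc k)) a b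
sqt-recurrence M k a b k≤N = begin
  coeff (sqt (suc N) (suc k)) a b
    ≡⟨ sqt-coeff N (suc k) a b (s≤s k≤N) ⟩
  s *ℤ sumPlacements (suc N) r (rookWeight (suc N) a b)
    ≡⟨ cong (s *ℤ_) (rookSum-suc N r a b) ⟩
  s *ℤ (sumPlacements N r (rookWeight N a b) +ℤ qtTimesPlacements N r a b)
    ≡⟨ ℤP.*-distribˡ-+ s _ _ ⟩
  s *ℤ sumPlacements N r (rookWeight N a b) +ℤ s *ℤ qtTimesPlacements N r a b
    ≡⟨ cong₂ _+ℤ_ (sym (sqt-coeff M k a b k≤N)) (qtTerm-sign M k a b k≤N) ⟩
  coeff (sqt N k) a b +ℤ - coeff (qtInt N *P sqt N (suc k)) a b
    ≡⟨ sym (coeff-+P (sqt N k) _ a b ⟨ trans ⟩ cong (coeff (sqt N k) a b +ℤ_) (coeff--P (qtInt N *P sqt N (suc k)) a b)) ⟩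
  coeff (sqt N k -P qtInt N *P sqt N (suc k)) a b ∎
  where
  open ≡-Reasoning
  N = suc M
  r = N ∸ k
  s = sign r

-- N ≥ 1 rooks never fit on the board of length N, which has N-1 columns.
sumPlacements-tooMany : ∀ N r g → PermInvariant g → N ≤ r → 1 ≤ r → sumPlacements N r g ≡ 0ℤ
sumPlacements-tooMany zero (suc r) g inv _ _ = refl
sumPlacements-tooMany (suc zero) (suc r) g inv _ _ = refl
sumPlacements-tooMany (suc (suc N)) (suc (suc r)) g inv (s≤s N≤r) _ =
  sumPlacements-suc (suc N) (suc (suc r)) g inv ⟨ trans ⟩
  cong₂ _+ℤ_ (sumPlacements-tooMany (suc N) (suc (suc r)) (g ∘ map shift) (λ p → inv (map⁺ shift p))
                                    (ℕP.m≤n⇒m≤1+n N≤r) (s≤s z≤n))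
             (sumPlacements-tooMany (suc N) (suc r) _ (λ p → sumL-ext (λ c → inv (prep c (map⁺ shift p))) (firstColumn (suc N)))
                                    N≤r (s≤s z≤n))

-- s[n,0] = δ_{n,0}: n rooks do not fit on the board of length n ≥ 1.
sqt-zero : ∀ n → sqt n 0 ≈P δ n
sqt-zero zero a b = refl
sqt-zero (suc N) a b =
  sqt-coeff N 0 a b z≤n ⟨ trans ⟩
  (cong (sign (suc N) *ℤ_) (sumPlacements-tooMany (suc N) (suc N) (rookWeight (suc N) a b) (rookWeight-invariant (suc N) a b)
                                                 ℕP.≤-refl (s≤s z≤n))
   ⟨ trans ⟩ ℤP.*-zeroʳ (sign (suc N)))

suc-⊔-nonzero : ∀ y m → (suc y ⊔ m ≡ᵇ 0) ≡ false
suc-⊔-nonzero y zero = refl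
suc-⊔-nonzero y (suc m) = refl

-- 𝒜(n,0) is empty: letters are positive, so is the maximum of a nonempty word.
inA-zero : ∀ n w → inA n 0 w ≡ false
inA-zero n [] = ∧-zeroʳ (0 ≡ᵇ n)
inA-zero n (zero ∷ ys) = ∧-zeroʳ _
inA-zero n (suc y ∷ ys) rewrite suc-⊔-nonzero y (maxL ys) =
  cong ((length (suc y ∷ ys) ≡ᵇ n) ∧_) (∧-zeroʳ _) ⟨ trans ⟩ ∧-zeroʳ _

Sqt-zero : ∀ n → Sqt n 0 ≈P δ n
Sqt-zero zero a b = refl
Sqt-zero (suc N) a b =
  Sqt-coeff N 0 a b ⟨ trans ⟩
  sumL-zero (λ w → cong (λ z → if z then coeffMono (1ℤ , Aw w , Bw w) a b else 0ℤ) (inA-zero (suc N) w))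
            (allWords (suc N) (suc N))

sqt-above : ∀ n k → n < k → sqt n k ≈P 0P
sqt-above zero (suc k) _ a b = refl
sqt-above (suc N) k n<k a b rewrite ≤ᵇ-false n<k = refl

inA-above : ∀ n k w → n < k → inA n k w ≡ false
inA-above n k w n<k with inA n k w in e
... | false = refl
... | true with ∧-true {length w ≡ᵇ n} e
... | _ , r with ∧-true {isRG w} r
... | _ , r′ with ∧-true {maxL w ≡ᵇ k} r′
... | maxIsK , _ = ⊥-elim (ℕP.<⇒≱ n<k (subst (_≤ n) (≡ᵇ-sound _ _ maxIsK) (inA-max n k w e)))

Sqt-above : ∀ n k → n < k → Sqt n k ≈P 0P
Sqt-above zero (suc k) _ a b = refl
Sqt-above (suc N) k n<k a b =
  Sqt-coeff N k a b ⟨ trans ⟩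
  sumL-zero (λ w → cong (λ z → if z then coeffMono (1ℤ , Aw w , Bw w) a b else 0ℤ) (inA-above (suc N) k w n<k))
            (allWords (suc N) (suc N))

corollary9p2 : ((n k : ℕ) → 1 ≤ n → 1 ≤ k → k ≤ n →
    (sqt n k ≈P sqt (n ∸ 1) (k ∸ 1) -P qtInt (n ∸ 1) *P sqt (n ∸ 1) k)
    × (Sqt n k ≈P Sqt (n ∸ 1) (k ∸ 1) +P qtInt k *P Sqt (n ∸ 1) k))
    × ((n : ℕ) → (sqt n 0 ≈P δ n) × (Sqt n 0 ≈P δ n))
    × ((n k : ℕ) → n < k → (sqt n k ≈P 0P) × (Sqt n k ≈P 0P))
corollary9p2 = recurrences , (λ n → sqt-zero n , Sqt-zero n) , (λ n k n<k → sqt-above n k n<k , Sqt-above n k n<k)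
  where
  recurrences : (n k : ℕ) → 1 ≤ n → 1 ≤ k → k ≤ n →
    (sqt n k ≈P sqt (n ∸ 1) (k ∸ 1) -P qtInt (n ∸ 1) *P sqt (n ∸ 1) k)
    × (Sqt n k ≈P Sqt (n ∸ 1) (k ∸ 1) +P qtInt k *P Sqt (n ∸ 1) k)
  -- For n = 1 both sides evaluate to the same lists; for n ≥ 2 use the recurrences.
  recurrences (suc zero) (suc zero) _ _ _ = (λ a b → refl) , (λ a b → refl)
  recurrences (suc zero) (suc (suc k)) _ _ (s≤s ())
  recurrences (suc (suc M)) (suc k) _ _ k+1≤n =
    (λ a b → sqt-recurrence M k a b (s≤s⁻¹ k+1≤n)) , (λ a b → Sqt-recurrence M k a b)
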